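{- Let $k\ge 1$ be an integer and define the formal power series $$F_k(y)=\sum_{\lambda\in\mathscr{P}} y^{\ell(\lambda)} z^{\mu_k(\lambda)} q^{|\lambda|},\qquad G_k(y)=\sum_{\lambda\in\mathscr{D}} y^{\ell(\lambda)} z^{\mu_k(\lambda)} q^{|\lambda|}.$$ Then $$F_k(y) - F_k(yq) = \frac{yzq}{(yq;q)_k}F_k(yq^k)$$ and $$G_k(y) - G_k(yq) = yzq(-yq^2;q)_{k-1}G_k(yq^k).$$
   Context: $\mathscr{P}$ denotes the set of all integer partitions and $\mathscr{D}$ the set of partitions into distinct parts (both including the empty partition). For a partition $\lambda$, $|\lambda|$ is the sum of its parts and $\ell(\lambda)$ is its number of parts. For a positive integer $k$, the $k$-measure $\mu_k(\lambda)$ is the length of the largest subsequence of parts of $\lambda$ (parts listed in order, with repetition allowed) in which the difference between any two consecutive parts of the subsequence is at least $k$. The $q$-Pochhammer symbol is $(A;q)_n=\prod_{j=0}^{n-1}(1-Aq^j)$. -}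

module Defs where

open import Data.Bool using (Bool; true; false; _∧_; if_then_else_)
open import Data.Nat as ℕ using (ℕ; zero; suc; _∸_; _⊔_; _≡ᵇ_; _≤ᵇ_; ∣_-_∣)
open import Data.Integer as ℤ using (ℤ; +_)
open import Data.List using (List; []; _∷_; _++_; map; concatMap; filter; length; foldr; upTo)
open import Data.Nat.ListAction using (sum)
open import Relation.Binary.PropositionalEquality using (_≡_)
open import Relation.Nullary.Decidable using (Dec)
open import Data.Bool.Properties using () renaming (_≟_ to _≟ᵇ_)

listsOf : ℕ → ℕ → List (List ℕ)
listsOf zero    b = [] ∷ []
listsOf (suc L) b = concatMap (λ p → map (p ∷_) (listsOf L b)) (map suc (upTo b))

candidates : ℕ → List (List ℕ)
candidates n = concatMap (λ L → listsOf L n) (upTo (suc n))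

nonIncreasing : List ℕ → Bool
nonIncreasing []           = true
nonIncreasing (x ∷ [])     = true
nonIncreasing (x ∷ y ∷ xs) = (y ≤ᵇ x) ∧ nonIncreasing (y ∷ xs)

strictlyDecreasing : List ℕ → Bool
strictlyDecreasing []           = true
strictlyDecreasing (x ∷ [])     = true
strictlyDecreasing (x ∷ y ∷ xs) = (suc y ≤ᵇ x) ∧ strictlyDecreasing (y ∷ xs)

isTrue : Bool → Set
isTrue b = b ≡ true

decB : (b : Bool) → Dec (isTrue b)
decB b = b ≟ᵇ true

partitions : ℕ → List (List ℕ)
partitions n = filter (λ xs → decB ((sum xs ≡ᵇ n) ∧ nonIncreasing xs)) (candidates n)

distinctPartitions : ℕ → List (List ℕ)
distinctPartitions n = filter (λ xs → decB ((sum xs ≡ᵇ n) ∧ strictlyDecreasing xs)) (candidates n)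

subsequences : List ℕ → List (List ℕ)
subsequences []       = [] ∷ []
subsequences (x ∷ xs) = map (x ∷_) (subsequences xs) ++ subsequences xs

kGapped : ℕ → List ℕ → Bool
kGapped k []           = true
kGapped k (x ∷ [])     = true
kGapped k (x ∷ y ∷ xs) = (k ≤ᵇ ∣ x - y ∣) ∧ kGapped k (y ∷ xs)

maximum : List ℕ → ℕ
maximum = foldr _⊔_ 0

μ : ℕ → List ℕ → ℕ
μ k λ′ = maximum (map length (filter (λ s → decB (kGapped k s)) (subsequences λ′)))

-- Formal power series in y, z, q over ℤ:
-- f a b n is the coefficient of y^a z^b q^n.

PS : Set
PS = ℕ → ℕ → ℕ → ℤ

_≈_ : PS → PS → Set
f ≈ g = ∀ a b n → f a b n ≡ g a b n

_-ₚ_ : PS → PS → PS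
(f -ₚ g) a b n = f a b n ℤ.- g a b n

sumTo : ℕ → (ℕ → ℤ) → ℤ
sumTo zero    f = f 0
sumTo (suc m) f = sumTo m f ℤ.+ f (suc m)

_*ₚ_ : PS → PS → PS
(f *ₚ g) a b n =
  sumTo a λ a₁ → sumTo b λ b₁ → sumTo n λ n₁ →
    f a₁ b₁ n₁ ℤ.* g (a ∸ a₁) (b ∸ b₁) (n ∸ n₁)

oneₚ : PS
oneₚ zero zero zero = + 1
oneₚ _    _    _    = + 0

mono : ℕ → ℕ → ℕ → PS
mono i j m a b n = if (a ≡ᵇ i) ∧ (b ≡ᵇ j) ∧ (n ≡ᵇ m) then + 1 else + 0

-- substitution y ↦ y q^j :  coefficient of y^a z^b q^n in f(y q^j)
substY : ℕ → PS → PS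
substY j f a b n = if j ℕ.* a ≤ᵇ n then f a b (n ∸ j ℕ.* a) else + 0

-- the factor (1 - c y q^d)
oneMinus : ℤ → ℕ → PS
oneMinus c d a b n =
  if (a ≡ᵇ 0) ∧ (b ≡ᵇ 0) ∧ (n ≡ᵇ 0) then + 1
  else if (a ≡ᵇ 1) ∧ (b ≡ᵇ 0) ∧ (n ≡ᵇ d) then ℤ.- c else + 0

-- its inverse in the ring of formal power series: Σ_m c^m y^m q^{dm}
invOneMinus : ℤ → ℕ → PS
invOneMinus c d a b n = if (b ≡ᵇ 0) ∧ (n ≡ᵇ d ℕ.* a) then c ℤ.^ a else + 0

poch : ℤ → ℕ → ℕ → PS
poch c d zero    = oneₚ
poch c d (suc m) = poch c d m *ₚ oneMinus c (d ℕ.+ m)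

invPoch : ℤ → ℕ → ℕ → PS
invPoch c d zero    = oneₚ
invPoch c d (suc m) = invPoch c d m *ₚ invOneMinus c (d ℕ.+ m)

count : List (List ℕ) → (List ℕ → Bool) → ℤ
count xs p = + length (filter (λ x → decB (p x)) xs)

F : ℕ → PS
F k a b n = count (partitions n) (λ λ′ → (length λ′ ≡ᵇ a) ∧ (μ k λ′ ≡ᵇ b))

G : ℕ → PS
G k a b n = count (distinctPartitions n) (λ λ′ → (length λ′ ≡ᵇ a) ∧ (μ k λ′ ≡ᵇ b))

-- F_k(y) - F_k(yq) counts the partitions having a part 1: subtracting 1 from every part of a
-- partition without a part 1 realises the substitution y ↦ yq. Split such a partition into its
-- parts above k and its parts at most k. A part 1 is at distance at least k from every part above k,
-- while two parts in [1, k] are closer than k, so μ_k grows by exactly one when the small parts are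
-- added. Subtracting k from the parts above k gives F_k(yq^k); the parts at most k are the part 1
-- (the factor yzq) and a partition into parts in [1, k], generated by 1/(yq;q)_k, or for 𝒟 into
-- distinct parts in [2, k], generated by (-yq²;q)_{k-1}.

module Submission where

open import Defs
open import Data.Nat using (ℕ; _≤_; _∸_)
open import Data.Integer using (-[1+_])
open import Data.Product using (_×_)

open import Data.Bool using (Bool; true; false; _∧_; _∨_; not; if_then_else_)
open import Data.Bool.Properties
  using (T-≡; if-float; if-eta; ∧-conicalˡ; ∧-conicalʳ; ∧-assoc; ∧-comm; ∧-zeroʳ; ∧-identityʳ; ∨-assoc; ∨-zeroʳ)
open import Data.Nat using (zero; suc; _+_; _*_; _<_; z≤n; s≤s; _≡ᵇ_; _≤ᵇ_; _<ᵇ_; ∣_-_∣)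
open import Data.Nat.Properties
open import Algebra.Properties.CommutativeSemigroup +-commutativeSemigroup using (interchange; x∙yz≈y∙xz)
open import Data.List
  using (List; []; _∷_; _++_; map; length; filter; cartesianProduct; concatMap; upTo; replicate)
open import Data.Bool.ListAction using (all)
open import Data.List.Properties
  using (length-map; length-++; length-replicate; map-++; map-∘; map-id-local; ∷-injectiveʳ)
open import Data.List.Membership.Propositional using (_∈_; find; lose)
open import Data.List.Membership.Propositional.Properties
open import Data.List.Membership.Propositional.Properties.WithK using (unique∧set⇒bag)
open import Data.List.Relation.Binary.BagAndSetEquality using (∼bag⇒↭)
open import Data.List.Relation.Binary.Permutation.Propositional.Properties using (↭-length)
open import Data.List.Relation.Unary.Any using (here; there)
open import Data.List.Relation.Unary.All as All using ([])
open import Data.List.Relation.Unary.Unique.Propositional using (Unique)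
open import Data.List.Relation.Unary.AllPairs using ([]; _∷_)
import Data.List.Relation.Unary.Unique.Propositional.Properties as Unique
open import Data.Nat.ListAction using (sum)
open import Data.Nat.ListAction.Properties using (sum-++)
open import Data.Product using (_,_; proj₁; proj₂; Σ)
open import Data.Sum using (_⊎_; inj₁; inj₂; map₂)
open import Data.Integer as ℤ using (ℤ)
import Data.Integer.Properties as ℤP
open import Data.Empty using (⊥-elim)
open import Function using (_∘_)
open import Function.Bundles using (Equivalence; _⇔_; mk⇔)
open import Relation.Binary.PropositionalEquality
open import Relation.Nullary using (¬_; yes; no; contradiction)

∧-trueˡ : ∀ {x y} → x ∧ y ≡ true → x ≡ true
∧-trueˡ {x} {y} = ∧-conicalˡ x y

∧-trueʳ : ∀ {x y} → x ∧ y ≡ true → y ≡ true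
∧-trueʳ {x} {y} = ∧-conicalʳ x y

∧-true⁺ : ∀ {x y} → x ≡ true → y ≡ true → x ∧ y ≡ true
∧-true⁺ refl refl = refl

fromBool : Bool → ℕ
fromBool false = 0
fromBool true  = 1

≤ᵇ⁺ : ∀ {m n} → m ≤ n → (m ≤ᵇ n) ≡ true
≤ᵇ⁺ p = Equivalence.to T-≡ (≤⇒≤ᵇ p)

≤ᵇ⁻ : ∀ {m n} → (m ≤ᵇ n) ≡ true → m ≤ n
≤ᵇ⁻ {m} {n} p = ≤ᵇ⇒≤ m n (Equivalence.from T-≡ p)

≤ᵇ-false⁺ : ∀ {m n} → ¬ (m ≤ n) → (m ≤ᵇ n) ≡ false
≤ᵇ-false⁺ {m} {n} m≰n with m ≤ᵇ n in eq
... | true  = ⊥-elim (m≰n (≤ᵇ⁻ eq))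
... | false = refl

≤ᵇ-false⁻ : ∀ {m n} → (m ≤ᵇ n) ≡ false → n < m
≤ᵇ-false⁻ {m} {n} p with m ≤? n
... | yes m≤n = contradiction (trans (sym (≤ᵇ⁺ m≤n)) p) λ ()
... | no m≰n  = ≰⇒> m≰n

≡ᵇ⁺ : ∀ {m n} → m ≡ n → (m ≡ᵇ n) ≡ true
≡ᵇ⁺ {m} {n} p = Equivalence.to T-≡ (≡⇒≡ᵇ m n p)

≡ᵇ⁻ : ∀ {m n} → (m ≡ᵇ n) ≡ true → m ≡ n
≡ᵇ⁻ {m} {n} p = ≡ᵇ⇒≡ m n (Equivalence.from T-≡ p)

≡ᵇ-false⁺ : ∀ {m n} → m ≢ n → (m ≡ᵇ n) ≡ false
≡ᵇ-false⁺ {m} {n} m≢n with m ≡ᵇ n in eq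
... | true  = ⊥-elim (m≢n (≡ᵇ⁻ eq))
... | false = refl

≡ᵇ-refl : ∀ n → (n ≡ᵇ n) ≡ true
≡ᵇ-refl n = ≡ᵇ⁺ {n} refl

-- Counting by bijection

record Enumerates {A : Set} (L : List A) (P : A → Set) : Set where
  field
    unique   : Unique L
    sound    : ∀ {x} → x ∈ L → P x
    complete : ∀ {x} → P x → x ∈ L
open Enumerates public

length-≡-by-bijection : {A B : Set} {L₁ : List A} {L₂ : List B} {P₁ : A → Set} {P₂ : B → Set} →
  Enumerates L₁ P₁ → Enumerates L₂ P₂ → (f : A → B) (g : B → A) →
  (∀ {x} → P₁ x → P₂ (f x)) → (∀ {y} → P₂ y → P₁ (g y)) →
  (∀ {x} → P₁ x → g (f x) ≡ x) → (∀ {y} → P₂ y → f (g y) ≡ y) → length L₁ ≡ length L₂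
length-≡-by-bijection {L₁ = L₁} {L₂} E₁ E₂ f g f∈ g∈ gf fg =
  trans (sym (length-map f L₁)) (↭-length (∼bag⇒↭ (unique∧set⇒bag image-unique (unique E₂) image≈L₂)))
  where
  g∘f≡id : map (g ∘ f) L₁ ≡ L₁
  g∘f≡id = map-id-local (All.tabulate (λ x∈ → gf (sound E₁ x∈)))
  image-unique : Unique (map f L₁)
  image-unique = Unique.map⁻ {f = g} (subst Unique (trans (sym g∘f≡id) (map-∘ L₁)) (unique E₁))
  image≈L₂ : ∀ {y} → y ∈ map f L₁ ⇔ y ∈ L₂
  image≈L₂ = mk⇔
    (λ y∈ → let (x , x∈ , y≡) = ∈-map⁻ f y∈ in subst (_∈ L₂) (sym y≡) (complete E₂ (f∈ (sound E₁ x∈))))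
    (λ y∈ → subst (_∈ map f L₁) (fg (sound E₂ y∈)) (∈-map⁺ f (complete E₁ (g∈ (sound E₂ y∈)))))

Enumerates-resp : {A : Set} {L : List A} {P Q : A → Set} →
  (∀ {x} → P x → Q x) → (∀ {x} → Q x → P x) → Enumerates L P → Enumerates L Q
Enumerates-resp P⇒Q Q⇒P E = record
  { unique = unique E ; sound = P⇒Q ∘ sound E ; complete = complete E ∘ Q⇒P }

Enumerates-singleton : {A : Set} (r : A) → Enumerates (r ∷ []) (_≡ r)
Enumerates-singleton r = record
  { unique = [] ∷ [] ; sound = λ { (here refl) → refl } ; complete = λ { refl → here refl } }

filterᵇ : {A : Set} → (A → Bool) → List A → List A
filterᵇ p = filter (λ x → decB (p x))

Enumerates-filterᵇ : {A : Set} {L : List A} {P : A → Set} (p : A → Bool) →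
  Enumerates L P → Enumerates (filterᵇ p L) (λ x → P x × p x ≡ true)
Enumerates-filterᵇ p E = record
  { unique   = Unique.filter⁺ (λ x → decB (p x)) (unique E)
  ; sound    = λ x∈ → let (x∈L , px) = ∈-filter⁻ (λ x → decB (p x)) x∈ in sound E x∈L , px
  ; complete = λ { (Px , px) → ∈-filter⁺ (λ x → decB (p x)) (complete E Px) px } }

Enumerates-cartesianProduct : {A B : Set} {L₁ : List A} {L₂ : List B} {P₁ : A → Set} {P₂ : B → Set} →
  Enumerates L₁ P₁ → Enumerates L₂ P₂ →
  Enumerates (cartesianProduct L₁ L₂) (λ xy → P₁ (proj₁ xy) × P₂ (proj₂ xy))
Enumerates-cartesianProduct {L₁ = L₁} {L₂} E₁ E₂ = record
  { unique   = Unique.cartesianProduct⁺ (unique E₁) (unique E₂)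
  ; sound    = λ xy∈ → let (x∈ , y∈) = ∈-cartesianProduct⁻ L₁ L₂ xy∈ in sound E₁ x∈ , sound E₂ y∈
  ; complete = λ { (P₁x , P₂y) → ∈-cartesianProduct⁺ (complete E₁ P₁x) (complete E₂ P₂y) } }

Unique-concatMap⁺ : {A B : Set} (f : A → List B) {xs : List A} → Unique xs → (∀ a → Unique (f a)) →
  (∀ {a a′ y} → y ∈ f a → y ∈ f a′ → a ≡ a′) → Unique (concatMap f xs)
Unique-concatMap⁺ f {[]}     _          _       _        = []
Unique-concatMap⁺ f {x ∷ xs} (x∉ ∷ xs!) f-unique disjoint =
  Unique.++⁺ (f-unique x) (Unique-concatMap⁺ f xs! f-unique disjoint) apart
  where
  apart : ∀ {v} → ¬ (v ∈ f x × v ∈ concatMap f xs)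
  apart (v∈fx , v∈rest) = let (a , a∈ , v∈fa) = find (∈-concatMap⁻ f v∈rest)
      in All.lookup x∉ a∈ (disjoint v∈fx v∈fa)

length-cartesianProduct : {A B : Set} (L₁ : List A) (L₂ : List B) →
  length (cartesianProduct L₁ L₂) ≡ length L₁ * length L₂
length-cartesianProduct []       L₂ = refl
length-cartesianProduct (x ∷ L₁) L₂ =
  trans (length-++ (map (x ,_) L₂)) (cong₂ _+_ (length-map _ L₂) (length-cartesianProduct L₁ L₂))

tally : {A : Set} → List A → (A → Bool) → ℕ
tally L p = length (filterᵇ p L)

tally-∷ : {A : Set} (p : A → Bool) (x : A) (L : List A) → tally (x ∷ L) p ≡ fromBool (p x) + tally L p
tally-∷ p x L with p x
... | true  = refl
... | false = refl

tally-cong : {A : Set} (L : List A) (p q : A → Bool) → (∀ {x} → x ∈ L → p x ≡ q x) → tally L p ≡ tally L q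
tally-cong []      p q p≗q = refl
tally-cong (x ∷ L) p q p≗q = begin
  tally (x ∷ L) p             ≡⟨ tally-∷ p x L ⟩
  fromBool (p x) + tally L p  ≡⟨ cong₂ _+_ (cong fromBool (p≗q (here refl))) (tally-cong L p q (p≗q ∘ there)) ⟩
  fromBool (q x) + tally L q  ≡⟨ tally-∷ q x L ⟨
  tally (x ∷ L) q             ∎
  where open ≡-Reasoning

tally-none : {A : Set} (L : List A) (p : A → Bool) → (∀ {x} → x ∈ L → p x ≡ false) → tally L p ≡ 0
tally-none []      p none = refl
tally-none (x ∷ L) p none rewrite tally-∷ p x L | none (here refl) = tally-none L p (none ∘ there)

tally-split : {A : Set} (L : List A) (p q : A → Bool) →
  tally L p ≡ tally L (λ x → p x ∧ q x) + tally L (λ x → p x ∧ not (q x))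
tally-split []      p q = refl
tally-split (x ∷ L) p q
  rewrite tally-∷ p x L | tally-∷ (λ x → p x ∧ q x) x L | tally-∷ (λ x → p x ∧ not (q x)) x L | tally-split L p q
  with p x | q x
... | true  | true  = refl
... | true  | false = sym (+-suc _ _)
... | false | _     = refl

sumToℕ : ℕ → (ℕ → ℕ) → ℕ
sumToℕ zero    f = f 0
sumToℕ (suc m) f = sumToℕ m f + f (suc m)

sumToℕ-+ : ∀ N f g → sumToℕ N (λ i → f i + g i) ≡ sumToℕ N f + sumToℕ N g
sumToℕ-+ zero    f g = refl
sumToℕ-+ (suc N) f g rewrite sumToℕ-+ N f g = interchange (sumToℕ N f) (sumToℕ N g) (f (suc N)) (g (suc N))

sumToℕ-zero : ∀ N f → (∀ i → i ≤ N → f i ≡ 0) → sumToℕ N f ≡ 0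
sumToℕ-zero zero    f f≡0 = f≡0 0 z≤n
sumToℕ-zero (suc N) f f≡0 rewrite sumToℕ-zero N f (λ i i≤N → f≡0 i (m≤n⇒m≤1+n i≤N)) = f≡0 (suc N) ≤-refl

sumToℕ-cong : ∀ N f g → (∀ i → i ≤ N → f i ≡ g i) → sumToℕ N f ≡ sumToℕ N g
sumToℕ-cong zero    f g f≗g = f≗g 0 z≤n
sumToℕ-cong (suc N) f g f≗g =
  cong₂ _+_ (sumToℕ-cong N f g (λ i i≤N → f≗g i (m≤n⇒m≤1+n i≤N))) (f≗g (suc N) ≤-refl)

sumToℕ-indicator : ∀ N s → s ≤ N → sumToℕ N (λ i → fromBool (s ≡ᵇ i)) ≡ 1
sumToℕ-indicator zero    .zero z≤n = refl
sumToℕ-indicator (suc N) s s≤1+N with s ≤? N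
... | yes s≤N rewrite sumToℕ-indicator N s s≤N | ≡ᵇ-false⁺ {s} {suc N} (λ e → 1+n≰n (subst (_≤ N) e s≤N)) = refl
... | no s≰N with ≤-antisym s≤1+N (≰⇒> s≰N)
... | refl rewrite ≡ᵇ-refl N
                 | sumToℕ-zero N (λ i → fromBool (suc N ≡ᵇ i))
                     (λ i i≤N → cong fromBool
                         (≡ᵇ-false⁺ {suc N} {i} (λ e → 1+n≰n (subst (_≤ N) (sym e) i≤N)))) = refl

tally-fibres : {A : Set} (L : List A) (p : A → Bool) (s : A → ℕ) (N : ℕ) →
  (∀ {x} → x ∈ L → p x ≡ true → s x ≤ N) →
  tally L p ≡ sumToℕ N (λ i → tally L (λ x → p x ∧ (s x ≡ᵇ i)))
tally-fibres []      p s N _     = sym (sumToℕ-zero N _ (λ _ _ → refl))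
tally-fibres {A} (x ∷ L) p s N s≤N = begin
  tally (x ∷ L) p
    ≡⟨ tally-∷ p x L ⟩
  fromBool (p x) + tally L p
    ≡⟨ cong₂ _+_ (head-fibre (p x) refl) (tally-fibres L p s N (s≤N ∘ there)) ⟩
  sumToℕ N (λ i → fromBool (p x ∧ (s x ≡ᵇ i))) + sumToℕ N (fibre L)
    ≡⟨ sumToℕ-+ N _ _ ⟨
  sumToℕ N (λ i → fromBool (p x ∧ (s x ≡ᵇ i)) + fibre L i)
    ≡⟨ sumToℕ-cong N _ _ (λ i _ → tally-∷ (λ y → p y ∧ (s y ≡ᵇ i)) x L) ⟨
  sumToℕ N (fibre (x ∷ L)) ∎
  where
  open ≡-Reasoning
  fibre : List A → ℕ → ℕ
  fibre M i = tally M (λ y → p y ∧ (s y ≡ᵇ i))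
  head-fibre : ∀ b → p x ≡ b → fromBool b ≡ sumToℕ N (λ i → fromBool (b ∧ (s x ≡ᵇ i)))
  head-fibre true  px = sym (sumToℕ-indicator N (s x) (s≤N (here refl) px))
  head-fibre false _  = sym (sumToℕ-zero N _ (λ _ _ → refl))

decreasingBy : ℕ → List ℕ → Bool
decreasingBy d []           = true
decreasingBy d (x ∷ [])     = true
decreasingBy d (x ∷ y ∷ xs) = (d + y ≤ᵇ x) ∧ decreasingBy d (y ∷ xs)

IsPartition : ℕ → ℕ → List ℕ → Set
IsPartition d n xs = (sum xs ≡ n) × (decreasingBy d xs ≡ true) × (all (1 ≤ᵇ_) xs ≡ true)

inRange : ℕ → ℕ → ℕ → Bool
inRange lo hi p = (lo ≤ᵇ p) ∧ (p ≤ᵇ hi)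

-- b = false encodes 𝒫 and b = true encodes 𝒟: consecutive parts differ by at least fromBool b.
partitionsOf : Bool → ℕ → List (List ℕ)
partitionsOf false = partitions
partitionsOf true  = distinctPartitions

∈-map-suc-upTo⁻ : ∀ {b p} → p ∈ map suc (upTo b) → inRange 1 b p ≡ true
∈-map-suc-upTo⁻ {b} p∈ with ∈-map⁻ suc p∈
... | i , i∈ , refl = ≤ᵇ⁺ {suc i} {b} (∈-upTo⁻ i∈)

∈-map-suc-upTo⁺ : ∀ {b p} → inRange 1 b p ≡ true → p ∈ map suc (upTo b)
∈-map-suc-upTo⁺ {b} {suc p} p∈ = ∈-map⁺ suc (∈-upTo⁺ (≤ᵇ⁻ {suc p} {b} p∈))

listsOf⁻ : ∀ L b {xs} → xs ∈ listsOf L b → (length xs ≡ L) × (all (inRange 1 b) xs ≡ true)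
listsOf⁻ zero    b (here refl) = refl , refl
listsOf⁻ (suc L) b xs∈ with find (∈-concatMap⁻ (λ p → map (p ∷_) (listsOf L b)) {map suc (upTo b)} xs∈)
... | p , p∈ , xs∈′ with ∈-map⁻ (p ∷_) xs∈′
... | ys , ys∈ , refl = let (length≡ , ys-in) = listsOf⁻ L b ys∈ in
    cong suc length≡ , ∧-true⁺ (∈-map-suc-upTo⁻ p∈) ys-in

listsOf⁺ : ∀ L b {xs} → length xs ≡ L → all (inRange 1 b) xs ≡ true → xs ∈ listsOf L b
listsOf⁺ zero    b {[]}     _       _     = here refl
listsOf⁺ (suc L) b {x ∷ xs} length≡ in-range =
  ∈-concatMap⁺ (λ p → map (p ∷_) (listsOf L b)) (lose (∈-map-suc-upTo⁺ (∧-trueˡ in-range))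
    (∈-map⁺ (x ∷_) (listsOf⁺ L b (suc-injective length≡) (∧-trueʳ {inRange 1 b x} in-range))))

listsOf-unique : ∀ L b → Unique (listsOf L b)
listsOf-unique zero    b = [] ∷ []
listsOf-unique (suc L) b = Unique-concatMap⁺ (λ p → map (p ∷_) (listsOf L b))
  (Unique.map⁺ suc-injective (Unique.upTo⁺ b)) (λ p → Unique.map⁺ ∷-injectiveʳ (listsOf-unique L b)) same-head
  where
  same-head : ∀ {a a′ y} → y ∈ map (a ∷_) (listsOf L b) → y ∈ map (a′ ∷_) (listsOf L b) → a ≡ a′
  same-head y∈ y∈′ with ∈-map⁻ _ y∈ | ∈-map⁻ _ y∈′
  ... | _ , _ , refl | _ , _ , refl = refl

IsCandidate : ℕ → List ℕ → Set
IsCandidate n xs = (length xs ≤ n) × (all (inRange 1 n) xs ≡ true)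

candidates-enumerates : ∀ n → Enumerates (candidates n) (IsCandidate n)
candidates-enumerates n = record
  { unique   = Unique-concatMap⁺ (λ L → listsOf L n) (Unique.upTo⁺ (suc n)) (λ L → listsOf-unique L n)
                 (λ xs∈ xs∈′ → trans (sym (proj₁ (listsOf⁻ _ n xs∈))) (proj₁ (listsOf⁻ _ n xs∈′)))
  ; sound    = λ xs∈ → let (L , L∈ , xs∈′) = find (∈-concatMap⁻ (λ L → listsOf L n) xs∈)
                           (length≡ , in-range) = listsOf⁻ L n xs∈′
                       in subst (_≤ n) (sym length≡) (≤-pred (∈-upTo⁻ L∈)) , in-range
  ; complete = λ { {xs} (length≤ , in-range) →
                   ∈-concatMap⁺ (λ L → listsOf L n) (lose (∈-upTo⁺ (s≤s length≤))
                       (listsOf⁺ (length xs) n refl in-range)) } }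

length≤sum : ∀ xs → all (1 ≤ᵇ_) xs ≡ true → length xs ≤ sum xs
length≤sum []           _   = z≤n
length≤sum (suc x ∷ xs) pos = s≤s (≤-trans (length≤sum xs pos) (m≤n+m (sum xs) x))

all-inRange-sum : ∀ xs n → all (1 ≤ᵇ_) xs ≡ true → sum xs ≤ n → all (inRange 1 n) xs ≡ true
all-inRange-sum []           n _   _      = refl
all-inRange-sum (suc x ∷ xs) n pos sum≤n =
  ∧-true⁺ (≤ᵇ⁺ {suc x} (≤-trans (m≤m+n (suc x) (sum xs)) sum≤n))
          (all-inRange-sum xs n pos (≤-trans (m≤n+m (sum xs) (suc x)) sum≤n))

all-inRange⇒positive : ∀ lo hi xs → all (inRange (suc lo) hi) xs ≡ true → all (1 ≤ᵇ_) xs ≡ true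
all-inRange⇒positive lo hi []       _        = refl
all-inRange⇒positive lo hi (x ∷ xs) in-range =
  ∧-true⁺ (≤ᵇ⁺ {1} {x} (≤-trans (s≤s z≤n) (≤ᵇ⁻ (∧-trueˡ (∧-trueˡ in-range)))))
          (all-inRange⇒positive lo hi xs (∧-trueʳ {inRange (suc lo) hi x} in-range))

isOrdered : Bool → List ℕ → Bool
isOrdered false = nonIncreasing
isOrdered true  = strictlyDecreasing

isOrdered≡decreasingBy : ∀ b xs → isOrdered b xs ≡ decreasingBy (fromBool b) xs
isOrdered≡decreasingBy false []           = refl
isOrdered≡decreasingBy true  []           = refl
isOrdered≡decreasingBy false (x ∷ [])     = refl
isOrdered≡decreasingBy true  (x ∷ [])     = refl
isOrdered≡decreasingBy false (x ∷ y ∷ xs) = cong (_ ∧_) (isOrdered≡decreasingBy false (y ∷ xs))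
isOrdered≡decreasingBy true  (x ∷ y ∷ xs) = cong (_ ∧_) (isOrdered≡decreasingBy true (y ∷ xs))

partitionsOf≡filter : ∀ b n → partitionsOf b n ≡ filterᵇ (λ xs → (sum xs ≡ᵇ n) ∧ isOrdered b xs) (candidates n)
partitionsOf≡filter false n = refl
partitionsOf≡filter true  n = refl

partitionsOf-enumerates : ∀ b n → Enumerates (partitionsOf b n) (IsPartition (fromBool b) n)
partitionsOf-enumerates b n rewrite partitionsOf≡filter b n =
  Enumerates-resp to from (Enumerates-filterᵇ (λ xs → (sum xs ≡ᵇ n) ∧ isOrdered b xs) (candidates-enumerates n))
  where
  to : ∀ {xs} → IsCandidate n xs × ((sum xs ≡ᵇ n) ∧ isOrdered b xs) ≡ true → IsPartition (fromBool b) n xs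
  to {xs} ((_ , in-range) , h) =
    ≡ᵇ⁻ (∧-trueˡ h) , trans (sym (isOrdered≡decreasingBy b xs)) (∧-trueʳ {sum xs ≡ᵇ n} h)
        , all-inRange⇒positive 0 n xs in-range
  from : ∀ {xs} → IsPartition (fromBool b) n xs → IsCandidate n xs × ((sum xs ≡ᵇ n) ∧ isOrdered b xs) ≡ true
  from {xs} (sum≡ , ordered , pos) =
    (subst (length xs ≤_) sum≡ (length≤sum xs pos) , all-inRange-sum xs n pos (≤-reflexive sum≡))
    , ∧-true⁺ (≡ᵇ⁺ sum≡) (trans (isOrdered≡decreasingBy b xs) ordered)

-- Splitting and shifting partitions

+-cancelˡ-≤ᵇ : ∀ s a b → (s + a ≤ᵇ s + b) ≡ (a ≤ᵇ b)
+-cancelˡ-≤ᵇ zero    a b = refl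
+-cancelˡ-≤ᵇ (suc s) a b = trans (suc≤ᵇsuc (s + a) (s + b)) (+-cancelˡ-≤ᵇ s a b)
  where
  suc≤ᵇsuc : ∀ a b → (suc a ≤ᵇ suc b) ≡ (a ≤ᵇ b)
  suc≤ᵇsuc zero    b = refl
  suc≤ᵇsuc (suc a) b = refl

+-cancelˡ-<ᵇ : ∀ s p → (s <ᵇ s + p) ≡ (0 <ᵇ p)
+-cancelˡ-<ᵇ zero    p = refl
+-cancelˡ-<ᵇ (suc s) p = +-cancelˡ-<ᵇ s p

<ᵇ-false⇒≤ᵇ : ∀ {t x} → (t <ᵇ x) ≡ false → (x ≤ᵇ t) ≡ true
<ᵇ-false⇒≤ᵇ {t} {x} t≮x = ≤ᵇ⁺ (≤-pred (≤ᵇ-false⁻ {suc t} {x} t≮x))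

≤ᵇ⇒<ᵇ-false : ∀ {t x} → (x ≤ᵇ t) ≡ true → (t <ᵇ x) ≡ false
≤ᵇ⇒<ᵇ-false {t} {x} x≤t = ≤ᵇ-false⁺ {suc t} {x} (λ t<x → <⇒≱ t<x (≤ᵇ⁻ x≤t))

all-++ : ∀ (p : ℕ → Bool) xs ys → all p (xs ++ ys) ≡ all p xs ∧ all p ys
all-++ p []       ys = refl
all-++ p (x ∷ xs) ys = trans (cong (p x ∧_) (all-++ p xs ys)) (sym (∧-assoc (p x) _ _))

all-++⁻ˡ : ∀ (p : ℕ → Bool) xs ys → all p (xs ++ ys) ≡ true → all p xs ≡ true
all-++⁻ˡ p xs ys h = ∧-trueˡ (trans (sym (all-++ p xs ys)) h)

all-++⁻ʳ : ∀ (p : ℕ → Bool) xs ys → all p (xs ++ ys) ≡ true → all p ys ≡ true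
all-++⁻ʳ p xs ys h = ∧-trueʳ {all p xs} (trans (sym (all-++ p xs ys)) h)

all-++⁺ : ∀ (p : ℕ → Bool) xs ys → all p xs ≡ true → all p ys ≡ true → all p (xs ++ ys) ≡ true
all-++⁺ p xs ys h₁ h₂ = trans (all-++ p xs ys) (∧-true⁺ h₁ h₂)

all-mono : ∀ {p q : ℕ → Bool} → (∀ x → p x ≡ true → q x ≡ true)
    → ∀ xs → all p xs ≡ true → all q xs ≡ true
all-mono p⇒q []       _ = refl
all-mono {p} p⇒q (x ∷ xs) h = ∧-true⁺ (p⇒q x (∧-trueˡ h)) (all-mono p⇒q xs (∧-trueʳ {p x} h))

all-cong : ∀ {p q : ℕ → Bool} → (∀ x → p x ≡ q x) → ∀ xs → all p xs ≡ all q xs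
all-cong p≗q []       = refl
all-cong p≗q (x ∷ xs) = cong₂ _∧_ (p≗q x) (all-cong p≗q xs)

all-map : ∀ (p : ℕ → Bool) (f : ℕ → ℕ) xs → all p (map f xs) ≡ all (p ∘ f) xs
all-map p f []       = refl
all-map p f (x ∷ xs) = cong (p (f x) ∧_) (all-map p f xs)

all-∧ : ∀ (p q : ℕ → Bool) xs → (all p xs ∧ all q xs) ≡ all (λ x → p x ∧ q x) xs
all-∧ p q []       = refl
all-∧ p q (x ∷ xs) with p x | q x
... | true  | true  = all-∧ p q xs
... | true  | false = ∧-zeroʳ (all p xs)
... | false | _     = refl

all-replicate : ∀ (p : ℕ → Bool) u c → p c ≡ true → all p (replicate u c) ≡ true
all-replicate p zero    c pc = refl
all-replicate p (suc u) c pc = ∧-true⁺ pc (all-replicate p u c pc)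

decreasingBy-tail : ∀ d x xs → decreasingBy d (x ∷ xs) ≡ true → decreasingBy d xs ≡ true
decreasingBy-tail d x []       _   = refl
decreasingBy-tail d x (y ∷ xs) dec = ∧-trueʳ {d + y ≤ᵇ x} dec

decreasingBy-head : ∀ d x xs → decreasingBy d (x ∷ xs) ≡ true → all (λ y → d + y ≤ᵇ x) xs ≡ true
decreasingBy-head d x []       _   = refl
decreasingBy-head d x (y ∷ ys) dec =
  ∧-true⁺ (∧-trueˡ dec) (all-mono below-x ys (decreasingBy-head d y ys (∧-trueʳ {d + y ≤ᵇ x} dec)))
  where
  below-x : ∀ w → (d + w ≤ᵇ y) ≡ true → (d + w ≤ᵇ x) ≡ true
  below-x w h = ≤ᵇ⁺ {d + w} {x} (≤-trans (≤ᵇ⁻ {d + w} {y} h) (≤-trans (m≤n+m y d) (≤ᵇ⁻ (∧-trueˡ dec))))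

decreasingBy-++⁻ : ∀ d xs ys → decreasingBy d (xs ++ ys) ≡ true
    → (decreasingBy d xs ≡ true) × (decreasingBy d ys ≡ true)
decreasingBy-++⁻ d []            ys dec = refl , dec
decreasingBy-++⁻ d (x ∷ [])      ys dec = refl , decreasingBy-tail d x ys dec
decreasingBy-++⁻ d (x ∷ x′ ∷ xs) ys dec =
  let (dec-xs , dec-ys) = decreasingBy-++⁻ d (x′ ∷ xs) ys (∧-trueʳ {d + x′ ≤ᵇ x} dec)
  in ∧-true⁺ (∧-trueˡ dec) dec-xs , dec-ys

decreasingBy-++⁺ : ∀ d c xs ys → decreasingBy d xs ≡ true → decreasingBy d ys ≡ true →
  all (c ≤ᵇ_) xs ≡ true → all (λ q → d + q ≤ᵇ c) ys ≡ true → decreasingBy d (xs ++ ys) ≡ true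
decreasingBy-++⁺ d c []            ys       _      dec-ys _      _      = dec-ys
decreasingBy-++⁺ d c (x ∷ [])      []       _      _      _      _      = refl
decreasingBy-++⁺ d c (x ∷ [])      (y ∷ ys) _      dec-ys xs≥c   ys≤c   =
  ∧-true⁺ (≤ᵇ⁺ {d + y} {x} (≤-trans (≤ᵇ⁻ (∧-trueˡ ys≤c)) (≤ᵇ⁻ (∧-trueˡ xs≥c)))) dec-ys
decreasingBy-++⁺ d c (x ∷ x′ ∷ xs) ys       dec-xs dec-ys xs≥c   ys≤c   =
  ∧-true⁺ (∧-trueˡ dec-xs)
      (decreasingBy-++⁺ d c (x′ ∷ xs) ys (∧-trueʳ {d + x′ ≤ᵇ x} dec-xs) dec-ys (∧-trueʳ {c ≤ᵇ x} xs≥c) ys≤c)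

partsAbove : ℕ → List ℕ → List ℕ
partsAbove t []       = []
partsAbove t (x ∷ xs) = if t <ᵇ x then x ∷ partsAbove t xs else partsAbove t xs

partsAtMost : ℕ → List ℕ → List ℕ
partsAtMost t []       = []
partsAtMost t (x ∷ xs) = if t <ᵇ x then partsAtMost t xs else x ∷ partsAtMost t xs

all-partsAbove : ∀ t xs → all (t <ᵇ_) (partsAbove t xs) ≡ true
all-partsAbove t []       = refl
all-partsAbove t (x ∷ xs) with t <ᵇ x in t<x
... | true  = ∧-true⁺ t<x (all-partsAbove t xs)
... | false = all-partsAbove t xs

all-partsAtMost : ∀ t xs → all (_≤ᵇ t) (partsAtMost t xs) ≡ true
all-partsAtMost t []       = refl
all-partsAtMost t (x ∷ xs) with t <ᵇ x in t<x
... | true  = all-partsAtMost t xs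
... | false = ∧-true⁺ (<ᵇ-false⇒≤ᵇ {t} {x} t<x) (all-partsAtMost t xs)

parts-++ : ∀ t β σ → all (t <ᵇ_) β ≡ true → all (_≤ᵇ t) σ ≡ true →
  (partsAbove t (β ++ σ) ≡ β) × (partsAtMost t (β ++ σ) ≡ σ)
parts-++ t []      []      _  _  = refl , refl
parts-++ t []      (q ∷ σ) _  σ≤t rewrite ≤ᵇ⇒<ᵇ-false {t} {q} (∧-trueˡ σ≤t) =
  let (above , atMost) = parts-++ t [] σ refl (∧-trueʳ {q ≤ᵇ t} σ≤t) in above , cong (q ∷_) atMost
parts-++ t (p ∷ β) σ β>t σ≤t rewrite ∧-trueˡ {t <ᵇ p} β>t =
  let (above , atMost) = parts-++ t β σ (∧-trueʳ {t <ᵇ p} β>t) σ≤t in cong (p ∷_) above , atMost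

partsAbove++partsAtMost : ∀ d t xs → decreasingBy d xs ≡ true → partsAbove t xs ++ partsAtMost t xs ≡ xs
partsAbove++partsAtMost d t []       _   = refl
partsAbove++partsAtMost d t (x ∷ xs) dec with t <ᵇ x in t<x
... | true  = cong (x ∷_) (partsAbove++partsAtMost d t xs (decreasingBy-tail d x xs dec))
... | false =
  let (above , atMost) = parts-++ t [] xs refl (all-mono below-t xs (decreasingBy-head d x xs dec))
  in trans (cong (_++ x ∷ partsAtMost t xs) above) (cong (x ∷_) atMost)
  where
  below-t : ∀ y → (d + y ≤ᵇ x) ≡ true → (y ≤ᵇ t) ≡ true
  below-t y h = ≤ᵇ⁺ (≤-trans (≤-trans (m≤n+m y d) (≤ᵇ⁻ h)) (≤ᵇ⁻ (<ᵇ-false⇒≤ᵇ {t} {x} t<x)))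

sum-map-+ : ∀ s ν → sum (map (s +_) ν) ≡ s * length ν + sum ν
sum-map-+ s []      = sym (trans (+-identityʳ _) (*-zeroʳ s))
sum-map-+ s (x ∷ ν) rewrite sum-map-+ s ν | *-suc s (length ν) = interchange s x (s * length ν) (sum ν)

decreasingBy-map-+ : ∀ d s ν → decreasingBy d (map (s +_) ν) ≡ decreasingBy d ν
decreasingBy-map-+ d s []          = refl
decreasingBy-map-+ d s (x ∷ [])    = refl
decreasingBy-map-+ d s (x ∷ y ∷ ν) =
  cong₂ _∧_ (trans (cong (_≤ᵇ s + x) (x∙yz≈y∙xz d s y)) (+-cancelˡ-≤ᵇ s (d + y) x))
      (decreasingBy-map-+ d s (y ∷ ν))

all->-map-+ : ∀ s ν → all (s <ᵇ_) (map (s +_) ν) ≡ all (1 ≤ᵇ_) ν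
all->-map-+ s ν = trans (all-map (s <ᵇ_) (s +_) ν) (all-cong (+-cancelˡ-<ᵇ s) ν)

map-+-∸ : ∀ s β → all (s <ᵇ_) β ≡ true → map (s +_) (map (_∸ s) β) ≡ β
map-+-∸ s []      _   = refl
map-+-∸ s (p ∷ β) β>s =
  cong₂ _∷_ (m+[n∸m]≡n (<⇒≤ (≤ᵇ⁻ {suc s} {p} (∧-trueˡ β>s)))) (map-+-∸ s β (∧-trueʳ {s <ᵇ p} β>s))

map-∸-+ : ∀ s ν → map (_∸ s) (map (s +_) ν) ≡ ν
map-∸-+ s []      = refl
map-∸-+ s (p ∷ ν) = cong₂ _∷_ (m+n∸m≡n s p) (map-∸-+ s ν)

*-length≤sum : ∀ s β → all (s <ᵇ_) β ≡ true → s * length β ≤ sum β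
*-length≤sum s []      _   = ≤-reflexive (*-zeroʳ s)
*-length≤sum s (p ∷ β) β>s = subst (_≤ p + sum β) (sym (*-suc s (length β)))
  (+-mono-≤ (<⇒≤ (≤ᵇ⁻ {suc s} {p} (∧-trueˡ β>s))) (*-length≤sum s β (∧-trueʳ {s <ᵇ p} β>s)))

-- Subtracting s from every part: the combinatorial side of the substitution y ↦ y q^s.
tally-shift : ∀ b s m x (R R′ : List ℕ → Bool) → (∀ ν → R (map (s +_) ν) ≡ R′ ν) →
  tally (partitionsOf b m) (λ β → (length β ≡ᵇ x) ∧ (all (s <ᵇ_) β ∧ R β)) ≡
  (if s * x ≤ᵇ m then tally (partitionsOf b (m ∸ s * x)) (λ ν → (length ν ≡ᵇ x) ∧ R′ ν) else 0)
tally-shift b s m x R R′ R∘shift with s * x ≤ᵇ m in fits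
... | false = tally-none (partitionsOf b m) _ (λ {β} β∈ → too-large β (sound (partitionsOf-enumerates b m) β∈))
  where
  too-large : ∀ β → IsPartition (fromBool b) m β → ((length β ≡ᵇ x) ∧ (all (s <ᵇ_) β ∧ R β)) ≡ false
  too-large β (sum≡ , _ , _) with length β ≡ᵇ x in length≡ | all (s <ᵇ_) β in β>s
  ... | false | _     = refl
  ... | true  | false = refl
  ... | true  | true  = ⊥-elim (<⇒≱ (≤ᵇ-false⁻ fits)
    (subst (λ l → s * l ≤ m) (≡ᵇ⁻ length≡) (subst (s * length β ≤_) sum≡ (*-length≤sum s β β>s))))
... | true = length-≡-by-bijection (Enumerates-filterᵇ above (partitionsOf-enumerates b m))
    (Enumerates-filterᵇ shifted (partitionsOf-enumerates b (m ∸ s * x))) (map (_∸ s)) (map (s +_))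
    (λ {β} h → to (map (_∸ s) β) (subst Above (sym (map-+-∸ s β (above⇒>s {β} h))) h)) (λ {ν} → from ν)
    (λ {β} h → map-+-∸ s β (above⇒>s {β} h)) (λ {ν} _ → map-∸-+ s ν)
  where
  d = fromBool b
  above : List ℕ → Bool
  above β = (length β ≡ᵇ x) ∧ (all (s <ᵇ_) β ∧ R β)
  shifted : List ℕ → Bool
  shifted ν = (length ν ≡ᵇ x) ∧ R′ ν
  Above : List ℕ → Set
  Above β = IsPartition d m β × above β ≡ true
  Shifted : List ℕ → Set
  Shifted ν = IsPartition d (m ∸ s * x) ν × shifted ν ≡ true
  above⇒>s : ∀ {β} → Above β → all (s <ᵇ_) β ≡ true
  above⇒>s {β} h = ∧-trueˡ (∧-trueʳ {length β ≡ᵇ x} (proj₂ h))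
  above-shift : ∀ ν → above (map (s +_) ν) ≡ (length ν ≡ᵇ x) ∧ (all (1 ≤ᵇ_) ν ∧ R′ ν)
  above-shift ν rewrite length-map (s +_) ν | all->-map-+ s ν | R∘shift ν = refl
  to : ∀ ν → Above (map (s +_) ν) → Shifted ν
  to ν ((sum≡ , dec , _) , h) rewrite above-shift ν =
    (trans (sym (m+n∸m≡n (s * x) (sum ν)))
           (cong (_∸ s * x) (trans (cong (λ l → s * l + sum ν) (sym (≡ᵇ⁻ (∧-trueˡ h))))
               (trans (sym (sum-map-+ s ν)) sum≡)))
    , trans (sym (decreasingBy-map-+ d s ν)) dec , ∧-trueˡ (∧-trueʳ {length ν ≡ᵇ x} h))
    , ∧-true⁺ (∧-trueˡ h) (∧-trueʳ {all (1 ≤ᵇ_) ν} (∧-trueʳ {length ν ≡ᵇ x} h))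
  from : ∀ ν → Shifted ν → Above (map (s +_) ν)
  from ν ((sum≡ , dec , pos) , h) =
    (trans (sum-map-+ s ν) (trans (cong₂ (λ l w → s * l + w) (≡ᵇ⁻ (∧-trueˡ h)) sum≡)
        (m+[n∸m]≡n (≤ᵇ⁻ {s * x} {m} fits)))
    , trans (decreasingBy-map-+ d s ν) dec
    , trans (all-map (1 ≤ᵇ_) (s +_) ν)
        (all-mono (λ p p≥1 → ≤ᵇ⁺ {1} (≤-trans (≤ᵇ⁻ {1} p≥1) (m≤n+m p s))) ν pos))
    , trans (above-shift ν) (∧-true⁺ (∧-trueˡ {length ν ≡ᵇ x} h) (∧-true⁺ pos (∧-trueʳ {length ν ≡ᵇ x} h)))

+≡⇒≡∸ : ∀ {m n o} → m + n ≡ o → m ≡ o ∸ n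
+≡⇒≡∸ {m} {n} m+n≡o = trans (sym (m+n∸n≡m m n)) (cong (_∸ n) m+n≡o)

-- A partition is the concatenation of its parts above t and its parts at most t, which factors the count.
module SplitAt (b : Bool) (t n a : ℕ) (Q Q₁ Q₂ : List ℕ → Bool)
  (Q-++ : ∀ β σ → all (t <ᵇ_) β ≡ true → all (_≤ᵇ t) σ ≡ true → all (1 ≤ᵇ_) σ ≡ true
      → Q (β ++ σ) ≡ Q₁ β ∧ Q₂ σ) where

  private
    d = fromBool b

    counted : List ℕ → Bool
    counted l = (length l ≡ᵇ a) ∧ Q l

    large : ℕ → List ℕ → Bool
    large a₁ β = (length β ≡ᵇ a ∸ a₁) ∧ (all (t <ᵇ_) β ∧ Q₁ β)

    small : ℕ → List ℕ → Bool
    small a₁ σ = (length σ ≡ᵇ a₁) ∧ (all (_≤ᵇ t) σ ∧ Q₂ σ)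

    fibre : ℕ → ℕ → List ℕ → Bool
    fibre a₁ n₁ l = (counted l ∧ (length (partsAtMost t l) ≡ᵇ a₁)) ∧ (sum (partsAtMost t l) ≡ᵇ n₁)

    Large : ℕ → ℕ → List ℕ → Set
    Large a₁ n₁ β = IsPartition d (n ∸ n₁) β × large a₁ β ≡ true

    Small : ℕ → ℕ → List ℕ → Set
    Small a₁ n₁ σ = IsPartition d n₁ σ × small a₁ σ ≡ true

    large⇒>t : ∀ a₁ β → large a₁ β ≡ true → all (t <ᵇ_) β ≡ true
    large⇒>t a₁ β h = ∧-trueˡ (∧-trueʳ {length β ≡ᵇ a ∸ a₁} h)

    small⇒≤t : ∀ a₁ σ → small a₁ σ ≡ true → all (_≤ᵇ t) σ ≡ true
    small⇒≤t a₁ σ h = ∧-trueˡ (∧-trueʳ {length σ ≡ᵇ a₁} h)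

    split : ∀ a₁ n₁ l → IsPartition d n l × fibre a₁ n₁ l ≡ true →
      Large a₁ n₁ (partsAbove t l) × Small a₁ n₁ (partsAtMost t l)
    split a₁ n₁ l ((sum≡ , dec , pos) , h) =
      ((trans (+≡⇒≡∸ (trans (sym (sum-++ β σ)) (trans (cong sum l≡) sum≡))) (cong (n ∸_) sum-σ)
          , proj₁ dec-β×dec-σ , all-++⁻ˡ (1 ≤ᵇ_) β σ pos′)
        , ∧-true⁺ (≡ᵇ⁺ (trans (+≡⇒≡∸ {length β} (trans (sym (length-++ β)) length≡)) (cong (a ∸_) length-σ)))
                  (∧-true⁺ (all-partsAbove t l) (∧-trueˡ {Q₁ β} Q₁Q₂)))
      , ((sum-σ , proj₂ dec-β×dec-σ , all-++⁻ʳ (1 ≤ᵇ_) β σ pos′)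
        , ∧-true⁺ (≡ᵇ⁺ length-σ) (∧-true⁺ (all-partsAtMost t l) (∧-trueʳ {Q₁ β} Q₁Q₂)))
      where
      β = partsAbove t l
      σ = partsAtMost t l
      l≡ : β ++ σ ≡ l
      l≡ = partsAbove++partsAtMost d t l dec
      counted-l : counted l ≡ true
      counted-l = ∧-trueˡ (∧-trueˡ h)
      length≡ : length (β ++ σ) ≡ a
      length≡ = trans (cong length l≡) (≡ᵇ⁻ (∧-trueˡ counted-l))
      length-σ : length σ ≡ a₁
      length-σ = ≡ᵇ⁻ (∧-trueʳ {counted l} (∧-trueˡ h))
      sum-σ : sum σ ≡ n₁
      sum-σ = ≡ᵇ⁻ (∧-trueʳ {counted l ∧ (length σ ≡ᵇ a₁)} h)
      pos′ : all (1 ≤ᵇ_) (β ++ σ) ≡ true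
      pos′ = subst (λ l′ → all (1 ≤ᵇ_) l′ ≡ true) (sym l≡) pos
      dec-β×dec-σ : (decreasingBy d β ≡ true) × (decreasingBy d σ ≡ true)
      dec-β×dec-σ = decreasingBy-++⁻ d β σ (subst (λ l′ → decreasingBy d l′ ≡ true) (sym l≡) dec)
      Q₁Q₂ : Q₁ β ∧ Q₂ σ ≡ true
      Q₁Q₂ = trans (sym (Q-++ β σ (all-partsAbove t l) (all-partsAtMost t l) (all-++⁻ʳ (1 ≤ᵇ_) β σ pos′)))
                   (trans (cong Q l≡) (∧-trueʳ {length l ≡ᵇ a} counted-l))

    join : ∀ a₁ n₁ β σ → a₁ ≤ a → n₁ ≤ n → Large a₁ n₁ β × Small a₁ n₁ σ →
      IsPartition d n (β ++ σ) × fibre a₁ n₁ (β ++ σ) ≡ true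
    join a₁ n₁ β σ a₁≤a n₁≤n (((sum-β , dec-β , pos-β) , large-β) , ((sum-σ , dec-σ , pos-σ) , small-σ)) =
      (trans (sum-++ β σ) (trans (cong₂ _+_ sum-β sum-σ) (m∸n+n≡m n₁≤n))
        , decreasingBy-++⁺ d (suc t) β σ dec-β dec-σ β>t (all-mono gap-below σ σ≤t)
        , all-++⁺ (1 ≤ᵇ_) β σ pos-β pos-σ)
      , ∧-true⁺ (∧-true⁺ (∧-true⁺ (≡ᵇ⁺ length≡)
          (trans (Q-++ β σ β>t σ≤t pos-σ) (∧-true⁺ Q₁β Q₂σ)))
                         (subst (λ s → (length s ≡ᵇ a₁) ≡ true) (sym atMost≡) (∧-trueˡ small-σ)))
                (subst (λ s → (sum s ≡ᵇ n₁) ≡ true) (sym atMost≡) (≡ᵇ⁺ sum-σ))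
      where
      β>t = large⇒>t a₁ β large-β
      σ≤t = small⇒≤t a₁ σ small-σ
      atMost≡ = proj₂ (parts-++ t β σ β>t σ≤t)
      Q₁β = ∧-trueʳ {all (t <ᵇ_) β} (∧-trueʳ {length β ≡ᵇ a ∸ a₁} large-β)
      Q₂σ = ∧-trueʳ {all (_≤ᵇ t) σ} (∧-trueʳ {length σ ≡ᵇ a₁} small-σ)
      length≡ : length (β ++ σ) ≡ a
      length≡ = trans (length-++ β)
        (trans (cong₂ _+_ (≡ᵇ⁻ {length β} (∧-trueˡ large-β)) (≡ᵇ⁻ {length σ} (∧-trueˡ small-σ)))
            (m∸n+n≡m a₁≤a))
      gap-below : ∀ q → (q ≤ᵇ t) ≡ true → (d + q ≤ᵇ suc t) ≡ true
      gap-below q q≤t = ≤ᵇ⁺ {d + q} {suc t} (≤-trans (+-monoˡ-≤ q (fromBool≤1 b)) (s≤s (≤ᵇ⁻ {q} {t} q≤t)))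
        where
        fromBool≤1 : ∀ b → fromBool b ≤ 1
        fromBool≤1 false = z≤n
        fromBool≤1 true  = s≤s z≤n

    tally-fibre : ∀ a₁ n₁ → a₁ ≤ a → n₁ ≤ n → tally (partitionsOf b n) (fibre a₁ n₁) ≡
      tally (partitionsOf b (n ∸ n₁)) (large a₁) * tally (partitionsOf b n₁) (small a₁)
    tally-fibre a₁ n₁ a₁≤a n₁≤n =
      trans (length-≡-by-bijection (Enumerates-filterᵇ (fibre a₁ n₁) (partitionsOf-enumerates b n))
              (Enumerates-cartesianProduct (Enumerates-filterᵇ (large a₁) (partitionsOf-enumerates b (n ∸ n₁)))
                                           (Enumerates-filterᵇ (small a₁) (partitionsOf-enumerates b n₁)))
              (λ l → partsAbove t l , partsAtMost t l) (λ βσ → proj₁ βσ ++ proj₂ βσ)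
              (λ {l} → split a₁ n₁ l) (λ {βσ} → join a₁ n₁ (proj₁ βσ) (proj₂ βσ) a₁≤a n₁≤n)
              (λ {l} h → partsAbove++partsAtMost d t l (proj₁ (proj₂ (proj₁ h))))
              (λ { {β , σ} ((_ , large-β) , (_ , small-σ)) →
                   let (above , atMost) = parts-++ t β σ (large⇒>t a₁ β large-β) (small⇒≤t a₁ σ small-σ)
                   in cong₂ _,_ above atMost }))
            (length-cartesianProduct (filterᵇ (large a₁) (partitionsOf b (n ∸ n₁)))
                                     (filterᵇ (small a₁) (partitionsOf b n₁)))

  tally≡convolution : tally (partitionsOf b n) counted ≡
    sumToℕ a (λ a₁ → sumToℕ n (λ n₁ → tally (partitionsOf b (n ∸ n₁)) (large a₁)
        * tally (partitionsOf b n₁) (small a₁)))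
  tally≡convolution =
    trans (tally-fibres L counted (λ l → length (partsAtMost t l)) a length-bound)
          (sumToℕ-cong a _ _ (λ a₁ a₁≤a →
            trans (tally-fibres L (λ l → counted l ∧ (length (partsAtMost t l) ≡ᵇ a₁)) (λ l → sum (partsAtMost t l)) n
                                (λ l∈ _ → sum-bound l∈))
                  (sumToℕ-cong n _ _ (λ n₁ n₁≤n → tally-fibre a₁ n₁ a₁≤a n₁≤n))))
    where
    L = partitionsOf b n
    split-parts : ∀ {l} → l ∈ L → partsAbove t l ++ partsAtMost t l ≡ l
    split-parts {l} l∈ = partsAbove++partsAtMost d t l (proj₁ (proj₂ (sound (partitionsOf-enumerates b n) l∈)))
    length-bound : ∀ {l} → l ∈ L → counted l ≡ true → length (partsAtMost t l) ≤ a
    length-bound {l} l∈ h = subst (length (partsAtMost t l) ≤_)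
      (trans (trans (sym (length-++ (partsAbove t l))) (cong length (split-parts l∈))) (≡ᵇ⁻ (∧-trueˡ h))) (m≤n+m _ _)
    sum-bound : ∀ {l} → l ∈ L → sum (partsAtMost t l) ≤ n
    sum-bound {l} l∈ = subst (sum (partsAtMost t l) ≤_)
      (trans (trans (sym (sum-++ (partsAbove t l) _)) (cong sum (split-parts l∈)))
          (proj₁ (sound (partitionsOf-enumerates b n) l∈)))
      (m≤n+m _ _)

sum-replicate : ∀ u c → sum (replicate u c) ≡ c * u
sum-replicate zero    c = sym (*-zeroʳ c)
sum-replicate (suc u) c = trans (cong (c +_) (sum-replicate u c)) (sym (*-suc c u))

≡replicate : ∀ t lo β → all (t <ᵇ_) β ≡ true → all (inRange lo (suc t)) β ≡ true
    → β ≡ replicate (length β) (suc t)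
≡replicate t lo []      _   _        = refl
≡replicate t lo (p ∷ β) β>t in-range =
  cong₂ _∷_ (≤-antisym (≤ᵇ⁻ {p} {suc t} (∧-trueʳ {lo ≤ᵇ p} (∧-trueˡ in-range)))
      (≤ᵇ⁻ {suc t} {p} (∧-trueˡ β>t)))
            (≡replicate t lo β (∧-trueʳ {t <ᵇ p} β>t) (∧-trueʳ {inRange lo (suc t) p} in-range))

tally-replicate : ∀ b t w u lo → lo ≤ suc t →
  tally (partitionsOf b w) (λ β → (length β ≡ᵇ u) ∧ (all (t <ᵇ_) β ∧ all (inRange lo (suc t)) β)) ≡
  fromBool ((w ≡ᵇ suc t * u) ∧ decreasingBy (fromBool b) (replicate u (suc t)))
tally-replicate b t w u lo lo≤ = by-cases _ refl
  where
  p : List ℕ → Bool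
  p β = (length β ≡ᵇ u) ∧ (all (t <ᵇ_) β ∧ all (inRange lo (suc t)) β)

  p⇒≡replicate : ∀ {β} → p β ≡ true → β ≡ replicate u (suc t)
  p⇒≡replicate {β} pβ =
    trans (≡replicate t lo β (∧-trueˡ β-parts) (∧-trueʳ {all (t <ᵇ_) β} β-parts))
          (cong (λ l → replicate l (suc t)) (≡ᵇ⁻ {length β} (∧-trueˡ pβ)))
    where
    β-parts = ∧-trueʳ {length β ≡ᵇ u} pβ

  by-cases : ∀ c → (w ≡ᵇ suc t * u) ∧ decreasingBy (fromBool b) (replicate u (suc t)) ≡ c
      → tally (partitionsOf b w) p ≡ fromBool c
  by-cases false is-partition = tally-none _ _ (λ {β} β∈ → none β (sound (partitionsOf-enumerates b w) β∈))
    where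
    none : ∀ β → IsPartition (fromBool b) w β → p β ≡ false
    none β (sum≡ , dec , _) with p β in pβ
    ... | false = refl
    ... | true  = contradiction
      (trans (sym (∧-true⁺ (≡ᵇ⁺ {w} (trans (sym sum≡) (trans (cong sum β≡) (sum-replicate u (suc t)))))
                           (trans (cong (decreasingBy (fromBool b)) (sym β≡)) dec)))
             is-partition) λ ()
      where
      β≡ : β ≡ replicate u (suc t)
      β≡ = p⇒≡replicate pβ
  by-cases true is-partition =
    length-≡-by-bijection (Enumerates-filterᵇ p (partitionsOf-enumerates b w)) (Enumerates-singleton (replicate u (suc t)))
      (λ β → β) (λ β → β) (λ h → p⇒≡replicate (proj₂ h)) replicate-counted (λ _ → refl) (λ _ → refl)
    where
    replicate-counted : ∀ {β} → β ≡ replicate u (suc t) → IsPartition (fromBool b) w β × p β ≡ true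
    replicate-counted refl =
      (trans (sum-replicate u (suc t)) (sym (≡ᵇ⁻ {w} (∧-trueˡ is-partition))) , ∧-trueʳ {w ≡ᵇ suc t * u} is-partition
        , all-replicate (1 ≤ᵇ_) u (suc t) refl)
      , ∧-true⁺ (≡ᵇ⁺ (length-replicate u))
                (∧-true⁺ (all-replicate (t <ᵇ_) u (suc t) (≤ᵇ⁺ {suc t} ≤-refl))
                         (all-replicate (inRange lo (suc t)) u (suc t) (∧-true⁺ (≤ᵇ⁺ lo≤) (≤ᵇ⁺ {suc t} ≤-refl))))

tally-emptyRange : ∀ b n a lo hi → hi < lo →
  tally (partitionsOf b n) (λ σ → (length σ ≡ᵇ a) ∧ all (inRange lo hi) σ) ≡ fromBool ((a ≡ᵇ 0) ∧ (n ≡ᵇ 0))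
tally-emptyRange false zero    zero    lo hi _     = refl
tally-emptyRange true  zero    zero    lo hi _     = refl
tally-emptyRange b     (suc n) zero    lo hi _     =
  tally-none _ _ (λ {σ} σ∈ → nonempty σ (sound (partitionsOf-enumerates b (suc n)) σ∈))
  where
  nonempty : ∀ σ → IsPartition (fromBool b) (suc n) σ → ((length σ ≡ᵇ 0) ∧ all (inRange lo hi) σ) ≡ false
  nonempty []      (() , _)
  nonempty (p ∷ σ) _ = refl
tally-emptyRange b     n       (suc a) lo hi hi<lo = tally-none (partitionsOf b n) _ (λ {σ} _ → out-of-range σ)
  where
  out-of-range : ∀ σ → ((length σ ≡ᵇ suc a) ∧ all (inRange lo hi) σ) ≡ false
  out-of-range []      = refl
  out-of-range (p ∷ σ) with lo ≤ᵇ p in lo≤p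
  ... | false = ∧-zeroʳ _
  ... | true rewrite ≤ᵇ-false⁺ {p} {hi} (λ p≤hi → <⇒≱ hi<lo (≤-trans (≤ᵇ⁻ {lo} {p} lo≤p) p≤hi)) =
    ∧-zeroʳ _

-- The k-measure

hasPartOne : List ℕ → Bool
hasPartOne []       = false
hasPartOne (x ∷ xs) = (x ≡ᵇ 1) ∨ hasPartOne xs

hasPartOne-++ : ∀ β σ → hasPartOne (β ++ σ) ≡ hasPartOne β ∨ hasPartOne σ
hasPartOne-++ []      σ = refl
hasPartOne-++ (x ∷ β) σ = trans (cong ((x ≡ᵇ 1) ∨_) (hasPartOne-++ β σ)) (sym (∨-assoc (x ≡ᵇ 1) _ _))

¬hasPartOne-above : ∀ k β → 1 ≤ k → all (k <ᵇ_) β ≡ true → hasPartOne β ≡ false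
¬hasPartOne-above k []      _   _   = refl
¬hasPartOne-above k (p ∷ β) 1≤k β>k
  rewrite ≡ᵇ-false⁺ {p} {1} (λ p≡1 → <⇒≱ (≤-trans (s≤s 1≤k) (≤ᵇ⁻ {suc k} {p} (∧-trueˡ β>k)))
      (≤-reflexive p≡1)) =
  ¬hasPartOne-above k β 1≤k (∧-trueʳ {k <ᵇ p} β>k)

subsequences-map : ∀ (f : ℕ → ℕ) ν → subsequences (map f ν) ≡ map (map f) (subsequences ν)
subsequences-map f []      = refl
subsequences-map f (x ∷ ν) rewrite subsequences-map f ν | map-++ (map f) (map (x ∷_) (subsequences ν)) (subsequences ν) =
  cong (_++ map (map f) (subsequences ν)) (trans (sym (map-∘ (subsequences ν))) (map-∘ (subsequences ν)))

[]∈subsequences : ∀ xs → [] ∈ subsequences xs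
[]∈subsequences []       = here refl
[]∈subsequences (x ∷ xs) = ∈-++⁺ʳ (map (x ∷_) (subsequences xs)) ([]∈subsequences xs)

subsequences-++⁻ : ∀ xs ys s → s ∈ subsequences (xs ++ ys) →
  Σ (List ℕ) λ s₁ → Σ (List ℕ) λ s₂ → (s₁ ∈ subsequences xs) × (s₂ ∈ subsequences ys) × (s ≡ s₁ ++ s₂)
subsequences-++⁻ []       ys s s∈ = [] , s , here refl , s∈ , refl
subsequences-++⁻ (x ∷ xs) ys s s∈ with ∈-++⁻ (map (x ∷_) (subsequences (xs ++ ys))) s∈
... | inj₁ s∈₁ with ∈-map⁻ (x ∷_) s∈₁
... | s′ , s′∈ , refl = let (s₁ , s₂ , s₁∈ , s₂∈ , s′≡) = subsequences-++⁻ xs ys s′ s′∈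
                        in x ∷ s₁ , s₂ , ∈-++⁺ˡ (∈-map⁺ (x ∷_) s₁∈) , s₂∈ , cong (x ∷_) s′≡
subsequences-++⁻ (x ∷ xs) ys s s∈ | inj₂ s∈₂ =
  let (s₁ , s₂ , s₁∈ , s₂∈ , s≡) = subsequences-++⁻ xs ys s s∈₂
  in s₁ , s₂ , ∈-++⁺ʳ (map (x ∷_) (subsequences xs)) s₁∈ , s₂∈ , s≡

subsequences-++⁺ : ∀ xs ys s₁ s₂ → s₁ ∈ subsequences xs → s₂ ∈ subsequences ys
    → (s₁ ++ s₂) ∈ subsequences (xs ++ ys)
subsequences-++⁺ []       ys .[] s₂ (here refl) s₂∈ = s₂∈
subsequences-++⁺ (x ∷ xs) ys s₁  s₂ s₁∈ s₂∈ with ∈-++⁻ (map (x ∷_) (subsequences xs)) s₁∈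
... | inj₁ s₁∈′ with ∈-map⁻ (x ∷_) s₁∈′
... | s′ , s′∈ , refl = ∈-++⁺ˡ (∈-map⁺ (x ∷_) (subsequences-++⁺ xs ys s′ s₂ s′∈ s₂∈))
subsequences-++⁺ (x ∷ xs) ys s₁ s₂ s₁∈ s₂∈ | inj₂ s₁∈′ =
  ∈-++⁺ʳ (map (x ∷_) (subsequences (xs ++ ys))) (subsequences-++⁺ xs ys s₁ s₂ s₁∈′ s₂∈)

all-subsequences : ∀ (p : ℕ → Bool) xs s → all p xs ≡ true → s ∈ subsequences xs → all p s ≡ true
all-subsequences p []       .[] _  (here refl) = refl
all-subsequences p (x ∷ xs) s   px s∈ with ∈-++⁻ (map (x ∷_) (subsequences xs)) s∈
... | inj₁ s∈₁ with ∈-map⁻ (x ∷_) s∈₁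
... | s′ , s′∈ , refl = ∧-true⁺ (∧-trueˡ px) (all-subsequences p xs s′ (∧-trueʳ {p x} px) s′∈)
all-subsequences p (x ∷ xs) s px s∈ | inj₂ s∈₂ = all-subsequences p xs s (∧-trueʳ {p x} px) s∈₂

[1]∈subsequences : ∀ σ → hasPartOne σ ≡ true → (1 ∷ []) ∈ subsequences σ
[1]∈subsequences (x ∷ σ) has1 with x ≡ᵇ 1 in x≡1
... | true  =
  subst (λ y → (1 ∷ []) ∈ subsequences (y ∷ σ)) (sym (≡ᵇ⁻ {x} {1} x≡1))
      (∈-++⁺ˡ (∈-map⁺ (1 ∷_) ([]∈subsequences σ)))
... | false = ∈-++⁺ʳ (map (x ∷_) (subsequences σ)) ([1]∈subsequences σ has1)

kGapped-map-+ : ∀ k s l → kGapped k (map (s +_) l) ≡ kGapped k l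
kGapped-map-+ k s []          = refl
kGapped-map-+ k s (x ∷ [])    = refl
kGapped-map-+ k s (x ∷ y ∷ l) = cong₂ _∧_ (cong (k ≤ᵇ_) (∣m+n-m+o∣≡∣n-o∣ s x y)) (kGapped-map-+ k s (y ∷ l))

kGapped-++⁻ˡ : ∀ k s₁ s₂ → kGapped k (s₁ ++ s₂) ≡ true → kGapped k s₁ ≡ true
kGapped-++⁻ˡ k []           s₂ _   = refl
kGapped-++⁻ˡ k (x ∷ [])     s₂ _   = refl
kGapped-++⁻ˡ k (x ∷ y ∷ s₁) s₂ gap =
  ∧-true⁺ (∧-trueˡ gap) (kGapped-++⁻ˡ k (y ∷ s₁) s₂ (∧-trueʳ {k ≤ᵇ ∣ x - y ∣} gap))

kGapped-++⁻ʳ : ∀ k s₁ s₂ → kGapped k (s₁ ++ s₂) ≡ true → kGapped k s₂ ≡ true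
kGapped-++⁻ʳ k []           s₂       gap = gap
kGapped-++⁻ʳ k (x ∷ [])     []       _   = refl
kGapped-++⁻ʳ k (x ∷ [])     (y ∷ s₂) gap = ∧-trueʳ {k ≤ᵇ ∣ x - y ∣} gap
kGapped-++⁻ʳ k (x ∷ y ∷ s₁) s₂       gap = kGapped-++⁻ʳ k (y ∷ s₁) s₂ (∧-trueʳ {k ≤ᵇ ∣ x - y ∣} gap)

∣1+m-1+n∣<k : ∀ m n k → m < k → n < k → ∣ suc m - suc n ∣ < k
∣1+m-1+n∣<k m n k m<k n<k =
  ≤-<-trans (≤-trans (≤-reflexive (∣m+n-m+o∣≡∣n-o∣ 1 m n)) (∣m-n∣≤m⊔n m n)) (⊔-lub m<k n<k)

kGapped-inRange : ∀ k s → all (inRange 1 k) s ≡ true → kGapped k s ≡ true → length s ≤ 1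
kGapped-inRange k []                  _        _   = z≤n
kGapped-inRange k (x ∷ [])            _        _   = s≤s z≤n
kGapped-inRange k (zero ∷ y ∷ s)      ()       _
kGapped-inRange k (suc x ∷ zero ∷ s)  in-range _   = contradiction (∧-trueʳ {inRange 1 k (suc x)} in-range) λ ()
kGapped-inRange k (suc x ∷ suc y ∷ s) in-range gap =
  ⊥-elim (<⇒≱ (∣1+m-1+n∣<k x y k (≤ᵇ⁻ (∧-trueʳ {1 ≤ᵇ suc x} (∧-trueˡ in-range)))
                                  (≤ᵇ⁻ (∧-trueˡ (∧-trueʳ {inRange 1 k (suc x)} in-range))))
              (≤ᵇ⁻ {k} (∧-trueˡ gap)))

kGapped-∷ʳ-1 : ∀ k s → kGapped k s ≡ true → all (k <ᵇ_) s ≡ true → kGapped k (s ++ 1 ∷ []) ≡ true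
kGapped-∷ʳ-1 k []          _   _   = refl
kGapped-∷ʳ-1 k (p ∷ [])    _   s>k = ∧-true⁺ (≤ᵇ⁺ {k} k≤∣p-1∣) refl
  where
  k<p = ≤ᵇ⁻ {suc k} {p} (∧-trueˡ s>k)
  k≤∣p-1∣ : k ≤ ∣ p - 1 ∣
  k≤∣p-1∣ = subst (k ≤_) (sym (m≤n⇒∣n-m∣≡n∸m {1} {p} (≤-trans (s≤s z≤n) k<p))) (∸-monoˡ-≤ 1 k<p)
kGapped-∷ʳ-1 k (p ∷ q ∷ s) gap s>k =
  ∧-true⁺ (∧-trueˡ gap) (kGapped-∷ʳ-1 k (q ∷ s) (∧-trueʳ {k ≤ᵇ ∣ p - q ∣} gap) (∧-trueʳ {k <ᵇ p} s>k))

μ-map-+ : ∀ k s ν → μ k (map (s +_) ν) ≡ μ k ν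
μ-map-+ k s ν =
  cong maximum (trans (cong (map length ∘ filterᵇ (kGapped k)) (subsequences-map (s +_) ν)) (gapped-lengths (subsequences ν)))
  where
  gapped-lengths : ∀ S → map length (filterᵇ (kGapped k) (map (map (s +_)) S)) ≡ map length (filterᵇ (kGapped k) S)
  gapped-lengths []      = refl
  gapped-lengths (x ∷ S) rewrite kGapped-map-+ k s x with kGapped k x
  ... | true  = cong₂ _∷_ (length-map _ x) (gapped-lengths S)
  ... | false = gapped-lengths S

≤-maximum : ∀ {n} ns → n ∈ ns → n ≤ maximum ns
≤-maximum (m ∷ ns) (here refl) = m≤m⊔n m (maximum ns)
≤-maximum (m ∷ ns) (there n∈) = ≤-trans (≤-maximum ns n∈) (m≤n⊔m m (maximum ns))

length≤μ : ∀ k l s → s ∈ subsequences l → kGapped k s ≡ true → length s ≤ μ k l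
length≤μ k l s s∈ gap = ≤-maximum _ (∈-map⁺ length (∈-filter⁺ (λ s → decB (kGapped k s)) s∈ gap))

μ-attained : ∀ k l → Σ (List ℕ) λ s → (s ∈ subsequences l) × (kGapped k s ≡ true) × (length s ≡ μ k l)
μ-attained k l with foldr-selective ⊔-sel 0 (map length (filterᵇ (kGapped k) (subsequences l)))
... | inj₁ μ≡0 = [] , []∈subsequences l , refl , sym μ≡0
... | inj₂ μ∈ with ∈-map⁻ length μ∈
... | s , s∈ , μ≡ = let (s∈′ , gap) = ∈-filter⁻ (λ s → decB (kGapped k s)) s∈ in s , s∈′ , gap , sym μ≡

1≤μ : ∀ k x xs → 1 ≤ μ k (x ∷ xs)
1≤μ k x xs = length≤μ k (x ∷ xs) (x ∷ []) (∈-++⁺ˡ (∈-map⁺ (x ∷_) ([]∈subsequences xs))) refl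

μ-++-smallParts : ∀ k β σ → all (k <ᵇ_) β ≡ true → all (inRange 1 k) σ ≡ true → hasPartOne σ ≡ true →
  μ k (β ++ σ) ≡ suc (μ k β)
μ-++-smallParts k β σ β>k σ∈[1,k] has1 = ≤-antisym ≤1+μ 1+μ≤
  where
  ≤1+μ : μ k (β ++ σ) ≤ suc (μ k β)
  ≤1+μ with μ-attained k (β ++ σ)
  ... | s , s∈ , gap , length≡ with subsequences-++⁻ β σ s s∈
  ... | s₁ , s₂ , s₁∈ , s₂∈ , refl = begin
    μ k (β ++ σ)              ≡⟨ length≡ ⟨
    length (s₁ ++ s₂)         ≡⟨ length-++ s₁ ⟩
    length s₁ + length s₂     ≤⟨ +-mono-≤ (length≤μ k β s₁ s₁∈ (kGapped-++⁻ˡ k s₁ s₂ gap))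
                                          (kGapped-inRange k s₂ (all-subsequences (inRange 1 k) σ s₂ σ∈[1,k] s₂∈)
                                              (kGapped-++⁻ʳ k s₁ s₂ gap)) ⟩
    μ k β + 1                 ≡⟨ +-comm (μ k β) 1 ⟩
    suc (μ k β)               ∎
    where open ≤-Reasoning
  1+μ≤ : suc (μ k β) ≤ μ k (β ++ σ)
  1+μ≤ with μ-attained k β
  ... | s , s∈ , gap , length≡ =
    subst (_≤ μ k (β ++ σ)) (trans (length-++ s) (trans (+-comm (length s) 1) (cong suc length≡)))
      (length≤μ k (β ++ σ) (s ++ 1 ∷ []) (subsequences-++⁺ β σ s (1 ∷ []) s∈ ([1]∈subsequences σ has1))
                (kGapped-∷ʳ-1 k s gap (all-subsequences (k <ᵇ_) β s β>k s∈)))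

μ-hasPartOne-++ : ∀ k c β σ → 1 ≤ k → all (k <ᵇ_) β ≡ true → all (_≤ᵇ k) σ ≡ true
    → all (1 ≤ᵇ_) σ ≡ true →
  ((μ k (β ++ σ) ≡ᵇ c) ∧ hasPartOne (β ++ σ)) ≡ ((suc (μ k β) ≡ᵇ c) ∧ hasPartOne σ)
μ-hasPartOne-++ k c β σ 1≤k β>k σ≤k σ≥1
  rewrite hasPartOne-++ β σ | ¬hasPartOne-above k β 1≤k β>k
  with hasPartOne σ in has1
... | true  rewrite μ-++-smallParts k β σ β>k (trans (sym (all-∧ (1 ≤ᵇ_) (_≤ᵇ k) σ)) (∧-true⁺ σ≥1 σ≤k)) has1 =
  refl
... | false = trans (∧-zeroʳ _) (sym (∧-zeroʳ _))

dropLast : List ℕ → List ℕ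
dropLast []           = []
dropLast (x ∷ [])     = []
dropLast (x ∷ y ∷ xs) = x ∷ dropLast (y ∷ xs)

dropLast-∷ʳ : ∀ xs y → dropLast (xs ++ y ∷ []) ≡ xs
dropLast-∷ʳ []            y = refl
dropLast-∷ʳ (x ∷ [])      y = refl
dropLast-∷ʳ (x ∷ x′ ∷ xs) y = cong (x ∷_) (dropLast-∷ʳ (x′ ∷ xs) y)

-- Parts are positive and decreasing, so a part 1 can only be the last one.
≡dropLast∷ʳ1 : ∀ d σ → decreasingBy d σ ≡ true → all (1 ≤ᵇ_) σ ≡ true → hasPartOne σ ≡ true
    → σ ≡ dropLast σ ++ 1 ∷ []
≡dropLast∷ʳ1 d (x ∷ []) _ _ has1 with x ≡ᵇ 1 in x≡1
... | true = cong (_∷ []) (≡ᵇ⁻ {x} {1} x≡1)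
≡dropLast∷ʳ1 d (x ∷ y ∷ σ) dec pos has1 =
  cong (x ∷_) (≡dropLast∷ʳ1 d (y ∷ σ) (decreasingBy-tail d x (y ∷ σ) dec) (∧-trueʳ {1 ≤ᵇ x} pos) tail-has1)
  where
  tail-has1 : hasPartOne (y ∷ σ) ≡ true
  tail-has1 with x ≡ᵇ 1 in x≡1
  ... | false = has1
  ... | true = cong (_∨ hasPartOne σ) (≡ᵇ⁺ {y} {1} (≤-antisym y≤1
      (≤ᵇ⁻ {1} {y} (∧-trueˡ (∧-trueʳ {1 ≤ᵇ x} pos)))))
    where
    y≤1 : y ≤ 1
    y≤1 = ≤-trans (m≤n+m y d) (subst (d + y ≤_) (≡ᵇ⁻ {x} {1} x≡1) (≤ᵇ⁻ {d + y} {x} (∧-trueˡ dec)))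

decreasingBy-∷ʳ : ∀ d xs q → decreasingBy d (xs ++ q ∷ []) ≡ true → all (λ p → d + q ≤ᵇ p) xs ≡ true
decreasingBy-∷ʳ d []       q _   = refl
decreasingBy-∷ʳ d (x ∷ xs) q dec =
  ∧-true⁺ (∧-trueˡ (all-++⁻ʳ (λ y → d + y ≤ᵇ x) xs (q ∷ []) (decreasingBy-head d x (xs ++ q ∷ []) dec)))
          (decreasingBy-∷ʳ d xs q (decreasingBy-tail d x (xs ++ q ∷ []) dec))

-- Removing the part 1; in 𝒟 the remaining parts are then at least 2, whence the lower bound 1 + fromBool b.
tally-removeOne : ∀ b k a n → 1 ≤ k →
  tally (partitionsOf b (suc n)) (λ σ → (length σ ≡ᵇ suc a) ∧ (all (_≤ᵇ k) σ ∧ hasPartOne σ)) ≡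
  tally (partitionsOf b n) (λ σ → (length σ ≡ᵇ a) ∧ all (inRange (suc (fromBool b)) k) σ)
tally-removeOne b k a n 1≤k =
  length-≡-by-bijection (Enumerates-filterᵇ withOne (partitionsOf-enumerates b (suc n)))
    (Enumerates-filterᵇ withoutOne (partitionsOf-enumerates b n)) dropLast (_++ 1 ∷ [])
    (λ {σ} → remove σ) (λ {σ} → add σ)
    (λ {σ} ((_ , dec , pos) , h) → sym (≡dropLast∷ʳ1 d σ dec pos (has1 σ h))) (λ {σ} _ → dropLast-∷ʳ σ 1)
  where
  d = fromBool b
  withOne : List ℕ → Bool
  withOne σ = (length σ ≡ᵇ suc a) ∧ (all (_≤ᵇ k) σ ∧ hasPartOne σ)
  withoutOne : List ℕ → Bool
  withoutOne σ = (length σ ≡ᵇ a) ∧ all (inRange (suc d) k) σ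
  has1 : ∀ σ → withOne σ ≡ true → hasPartOne σ ≡ true
  has1 σ h = ∧-trueʳ {all (_≤ᵇ k) σ} (∧-trueʳ {length σ ≡ᵇ suc a} h)

  remove∷ʳ : ∀ σ → IsPartition d (suc n) (σ ++ 1 ∷ []) → withOne (σ ++ 1 ∷ []) ≡ true
      → IsPartition d n σ × withoutOne σ ≡ true
  remove∷ʳ σ (sum≡ , dec , pos) h =
    (suc-injective (trans (trans (+-comm 1 (sum σ)) (sym (sum-++ σ (1 ∷ [])))) sum≡)
      , proj₁ (decreasingBy-++⁻ d σ (1 ∷ []) dec) , all-++⁻ˡ (1 ≤ᵇ_) σ (1 ∷ []) pos)
    , ∧-true⁺ (≡ᵇ⁺ (suc-injective (trans (trans (+-comm 1 (length σ)) (sym (length-++ σ))) (≡ᵇ⁻ (∧-trueˡ h)))))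
              (trans (sym (all-∧ (suc d ≤ᵇ_) (_≤ᵇ k) σ))
                     (∧-true⁺ (trans (all-cong (λ p → cong (_≤ᵇ p) (+-comm 1 d)) σ) (decreasingBy-∷ʳ d σ 1 dec))

                                  (all-++⁻ˡ (_≤ᵇ k) σ (1 ∷ []) (∧-trueˡ (∧-trueʳ {length (σ ++ 1 ∷ []) ≡ᵇ suc a} h)))))

  remove : ∀ σ → IsPartition d (suc n) σ × withOne σ ≡ true
      → IsPartition d n (dropLast σ) × withoutOne (dropLast σ) ≡ true
  remove σ ((sum≡ , dec , pos) , h) =
    let σ≡ = ≡dropLast∷ʳ1 d σ dec pos (has1 σ h) in
    remove∷ʳ (dropLast σ) (subst (IsPartition d (suc n)) σ≡ (sum≡ , dec , pos)) (subst (λ s → withOne s ≡ true) σ≡ h)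

  add : ∀ σ → IsPartition d n σ × withoutOne σ ≡ true
      → IsPartition d (suc n) (σ ++ 1 ∷ []) × withOne (σ ++ 1 ∷ []) ≡ true
  add σ ((sum≡ , dec , pos) , h) =
    (trans (sum-++ σ (1 ∷ [])) (trans (+-comm (sum σ) 1) (cong suc sum≡))
      , decreasingBy-++⁺ d (suc d) σ (1 ∷ []) dec refl (all-mono (λ _ → ∧-trueˡ) σ in-range)
                         (∧-true⁺ (≤ᵇ⁺ {d + 1} {suc d} (≤-reflexive (+-comm d 1))) refl)
      , all-++⁺ (1 ≤ᵇ_) σ (1 ∷ []) pos refl)
    , ∧-true⁺ (≡ᵇ⁺ (trans (length-++ σ) (trans (+-comm (length σ) 1)
        (cong suc (≡ᵇ⁻ {length σ} {a} (∧-trueˡ h))))))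
              (∧-true⁺ (all-++⁺ (_≤ᵇ k) σ (1 ∷ []) σ≤k (∧-true⁺ (≤ᵇ⁺ {1} {k} 1≤k) refl))
                       (trans (hasPartOne-++ σ (1 ∷ [])) (∨-zeroʳ (hasPartOne σ))))
    where
    in-range = ∧-trueʳ {length σ ≡ᵇ a} h
    σ≤k = all-mono (λ p → ∧-trueʳ {suc d ≤ᵇ p}) σ in-range

-- Coefficients of power series

sumTo-cong : ∀ N f g → (∀ i → i ≤ N → f i ≡ g i) → sumTo N f ≡ sumTo N g
sumTo-cong zero    f g f≗g = f≗g 0 z≤n
sumTo-cong (suc N) f g f≗g = cong₂ ℤ._+_ (sumTo-cong N f g (λ i i≤N → f≗g i (m≤n⇒m≤1+n i≤N)))
    (f≗g (suc N) ≤-refl)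

sumTo-zero : ∀ N f → (∀ i → i ≤ N → f i ≡ ℤ.+ 0) → sumTo N f ≡ ℤ.+ 0
sumTo-zero zero    f f≡0 = f≡0 0 z≤n
sumTo-zero (suc N) f f≡0 rewrite sumTo-zero N f (λ i i≤N → f≡0 i (m≤n⇒m≤1+n i≤N)) | f≡0 (suc N) ≤-refl = refl

sumTo-pos : ∀ N f → ℤ.+ sumToℕ N f ≡ sumTo N (λ i → ℤ.+ f i)
sumTo-pos zero    f = refl
sumTo-pos (suc N) f = trans (ℤP.pos-+ (sumToℕ N f) (f (suc N))) (cong (ℤ._+ ℤ.+ f (suc N)) (sumTo-pos N f))

sumTo-single : ∀ N c f → (∀ i → i ≤ N → i ≢ c → f i ≡ ℤ.+ 0)
    → sumTo N f ≡ (if c ≤ᵇ N then f c else ℤ.+ 0)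
sumTo-single N c f f≡0 with c ≤ᵇ N in c≤N
... | false =
  sumTo-zero N f (λ i i≤N → f≡0 i i≤N (λ i≡c → <⇒≱ (≤ᵇ-false⁻ {c} {N} c≤N) (subst (_≤ N) i≡c i≤N)))
... | true  = go N (≤ᵇ⁻ {c} {N} c≤N) f≡0
  where
  go : ∀ N → c ≤ N → (∀ i → i ≤ N → i ≢ c → f i ≡ ℤ.+ 0) → sumTo N f ≡ f c
  go zero    z≤n     _   = refl
  go (suc N) c≤1+N f≡0 with c ≤? N
  ... | yes c≤N
    rewrite go N c≤N (λ i i≤N → f≡0 i (m≤n⇒m≤1+n i≤N))
          | f≡0 (suc N) ≤-refl (λ 1+N≡c → 1+n≰n (subst (_≤ N) (sym 1+N≡c) c≤N)) = ℤP.+-identityʳ (f c)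
  ... | no c≰N with ≤-antisym c≤1+N (≰⇒> c≰N)
  ... | refl
    rewrite sumTo-zero N f (λ i i≤N → f≡0 i (m≤n⇒m≤1+n i≤N) (λ i≡1+N → 1+n≰n (subst (_≤ N) i≡1+N i≤N))) =
    ℤP.+-identityˡ (f (suc N))

sumTo-if : ∀ N (v : Bool) g → sumTo N (λ i → if v then g i else ℤ.+ 0) ≡ (if v then sumTo N g else ℤ.+ 0)
sumTo-if N true  g = refl
sumTo-if N false g = sumTo-zero N _ (λ _ _ → refl)

*ₚ-concentratedˡ : ∀ (X Y : PS) c → (∀ a₁ c₁ n₁ → c₁ ≢ c → X a₁ c₁ n₁ ≡ ℤ.+ 0) → ∀ a b n →
  (X *ₚ Y) a b n ≡
  (if c ≤ᵇ b then sumTo a (λ a₁ → sumTo n (λ n₁ → X a₁ c n₁ ℤ.* Y (a ∸ a₁) (b ∸ c) (n ∸ n₁)))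
      else ℤ.+ 0)
*ₚ-concentratedˡ X Y c X≡0 a b n =
  trans (sumTo-cong a _ (λ a₁ → if c ≤ᵇ b then term a₁ c else ℤ.+ 0)
          (λ a₁ _ → sumTo-single b c (term a₁)
              (λ c₁ _ c₁≢c → sumTo-zero n _ (λ n₁ _ → cong (ℤ._* _) (X≡0 a₁ c₁ n₁ c₁≢c)))))
        (sumTo-if a (c ≤ᵇ b) (λ a₁ → term a₁ c))
  where
  term : ℕ → ℕ → ℤ
  term a₁ c₁ = sumTo n (λ n₁ → X a₁ c₁ n₁ ℤ.* Y (a ∸ a₁) (b ∸ c₁) (n ∸ n₁))

mono-*ₚ : ∀ (Y : PS) a b n →
  (mono 1 1 1 *ₚ Y) a b n ≡ (if (1 ≤ᵇ a) ∧ (1 ≤ᵇ b) ∧ (1 ≤ᵇ n) then Y (a ∸ 1) (b ∸ 1) (n ∸ 1) else ℤ.+ 0)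
mono-*ₚ Y a b n =
  trans (sumTo-cong a _ (λ a₁ → sumTo b (λ b₁ → at-n a₁ b₁))
          (λ a₁ _ → sumTo-cong b _ _ (λ b₁ _ →
            sumTo-single n 1 (term a₁ b₁) (λ n₁ _ n₁≢1 → term≡0 a₁ b₁ n₁ (inj₂ (inj₂ n₁≢1))))))
  (trans (sumTo-cong a _ (λ a₁ → if 1 ≤ᵇ b then at-n a₁ 1 else ℤ.+ 0)
          (λ a₁ _ → sumTo-single b 1 (at-n a₁) (λ b₁ _ b₁≢1 → at-n≡0 a₁ b₁ (inj₂ b₁≢1))))
  (trans (sumTo-single a 1 (λ a₁ → if 1 ≤ᵇ b then at-n a₁ 1 else ℤ.+ 0) (λ a₁ _ a₁≢1 → at-b≡0 a₁ a₁≢1))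
         (nested-if (1 ≤ᵇ a) (1 ≤ᵇ b) (1 ≤ᵇ n) (ℤP.*-identityˡ (Y (a ∸ 1) (b ∸ 1) (n ∸ 1))))))
  where
  term : ℕ → ℕ → ℕ → ℤ
  term a₁ b₁ n₁ = mono 1 1 1 a₁ b₁ n₁ ℤ.* Y (a ∸ a₁) (b ∸ b₁) (n ∸ n₁)
  at-n : ℕ → ℕ → ℤ
  at-n a₁ b₁ = if 1 ≤ᵇ n then term a₁ b₁ 1 else ℤ.+ 0
  term≡0 : ∀ a₁ b₁ n₁ → a₁ ≢ 1 ⊎ b₁ ≢ 1 ⊎ n₁ ≢ 1 → term a₁ b₁ n₁ ≡ ℤ.+ 0
  term≡0 a₁ b₁ n₁ (inj₁ a₁≢1) rewrite ≡ᵇ-false⁺ {a₁} {1} a₁≢1 = refl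
  term≡0 a₁ b₁ n₁ (inj₂ (inj₁ b₁≢1)) rewrite ≡ᵇ-false⁺ {b₁} {1} b₁≢1 | ∧-zeroʳ (a₁ ≡ᵇ 1) = refl
  term≡0 a₁ b₁ n₁ (inj₂ (inj₂ n₁≢1))
    rewrite ≡ᵇ-false⁺ {n₁} {1} n₁≢1 | ∧-zeroʳ (b₁ ≡ᵇ 1) | ∧-zeroʳ (a₁ ≡ᵇ 1) = refl
  at-n≡0 : ∀ a₁ b₁ → a₁ ≢ 1 ⊎ b₁ ≢ 1 → at-n a₁ b₁ ≡ ℤ.+ 0
  at-n≡0 a₁ b₁ ne with 1 ≤ᵇ n
  ... | true  = term≡0 a₁ b₁ 1 (map₂ inj₁ ne)
  ... | false = refl
  at-b≡0 : ∀ a₁ → a₁ ≢ 1 → (if 1 ≤ᵇ b then at-n a₁ 1 else ℤ.+ 0) ≡ ℤ.+ 0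
  at-b≡0 a₁ a₁≢1 with 1 ≤ᵇ b
  ... | true  = at-n≡0 a₁ 1 (inj₁ a₁≢1)
  ... | false = refl
  nested-if : ∀ p q r {u v : ℤ} → u ≡ v →
    (if p then (if q then (if r then u else ℤ.+ 0) else ℤ.+ 0) else ℤ.+ 0) ≡ (if p ∧ q ∧ r then v else ℤ.+ 0)
  nested-if true  true  true  u≡v = u≡v
  nested-if true  true  false _   = refl
  nested-if true  false _     _   = refl
  nested-if false _     _     _   = refl

*ₚ-congˡ : ∀ {X X′} (Y : PS) → X ≈ X′ → (X *ₚ Y) ≈ (X′ *ₚ Y)
*ₚ-congˡ Y X≈X′ a b n =
  sumTo-cong a _ _ (λ a₁ _ → sumTo-cong b _ _ (λ b₁ _ → sumTo-cong n _ _ (λ n₁ _ →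
    cong (ℤ._* _) (X≈X′ a₁ b₁ n₁))))

+[m*n]≡+n*+m : ∀ m n → ℤ.+ (m * n) ≡ ℤ.+ n ℤ.* ℤ.+ m
+[m*n]≡+n*+m m n = trans (cong ℤ.+_ (*-comm m n)) (ℤP.pos-* n m)

-- Σ y^{ℓ(σ)} q^{|σ|} over the partitions σ of class b whose parts all lie in [lo, hi].
rangeGF : Bool → ℕ → ℕ → PS
rangeGF b lo hi a c n =
  if c ≡ᵇ 0 then ℤ.+ tally (partitionsOf b n) (λ σ → (length σ ≡ᵇ a) ∧ all (inRange lo hi) σ) else ℤ.+ 0

rangeGF-empty : ∀ b lo hi → hi < lo → oneₚ ≈ rangeGF b lo hi
rangeGF-empty b lo hi hi<lo a c n rewrite tally-emptyRange b n a lo hi hi<lo = oneₚ≡ a c n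
  where
  oneₚ≡ : ∀ a c n → oneₚ a c n ≡ (if c ≡ᵇ 0 then ℤ.+ fromBool ((a ≡ᵇ 0) ∧ (n ≡ᵇ 0)) else ℤ.+ 0)
  oneₚ≡ zero    zero    zero    = refl
  oneₚ≡ zero    zero    (suc n) = refl
  oneₚ≡ zero    (suc c) n       = refl
  oneₚ≡ (suc a) zero    n       = refl
  oneₚ≡ (suc a) (suc c) n       = refl

all-≤ᵇ-inRange : ∀ t lo σ → (all (_≤ᵇ t) σ ∧ all (inRange lo (suc t)) σ) ≡ all (inRange lo t) σ
all-≤ᵇ-inRange t lo σ = trans (all-∧ (_≤ᵇ t) (inRange lo (suc t)) σ) (all-cong ≤t∧inRange σ)
  where
  ≤t∧inRange : ∀ p → ((p ≤ᵇ t) ∧ inRange lo (suc t) p) ≡ inRange lo t p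
  ≤t∧inRange p with p ≤ᵇ t in p≤t
  ... | true rewrite ≤ᵇ⁺ {p} {suc t} (m≤n⇒m≤1+n (≤ᵇ⁻ {p} {t} p≤t)) = refl
  ... | false = sym (∧-zeroʳ _)

-- Multiplying by the generating function of the partitions into copies of t + 1 adds t + 1 to the allowed parts.
rangeGF-*ₚ : ∀ b lo t (Y : PS) → lo ≤ suc t →
  (∀ u w → Y u 0 w ≡ ℤ.+ fromBool ((w ≡ᵇ suc t * u) ∧ decreasingBy (fromBool b) (replicate u (suc t)))) →
  (∀ u c w → Y u (suc c) w ≡ ℤ.+ 0) →
  (rangeGF b lo t *ₚ Y) ≈ rangeGF b lo (suc t)
rangeGF-*ₚ b lo t Y lo≤ Y₀ Y₊ a c n = trans (*ₚ-concentratedˡ (rangeGF b lo t) Y 0 off-degree a c n) (by-degree c)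
  where
  off-degree : ∀ a₁ c₁ n₁ → c₁ ≢ 0 → rangeGF b lo t a₁ c₁ n₁ ≡ ℤ.+ 0
  off-degree a₁ zero    n₁ c₁≢0 = ⊥-elim (c₁≢0 refl)
  off-degree a₁ (suc _) n₁ _    = refl
  Q : List ℕ → Bool
  Q = all (inRange lo (suc t))
  term : ∀ a₁ n₁ →
    ℤ.+ (tally (partitionsOf b (n ∸ n₁)) (λ β → (length β ≡ᵇ a ∸ a₁) ∧ (all (t <ᵇ_) β ∧ Q β))
         * tally (partitionsOf b n₁) (λ σ → (length σ ≡ᵇ a₁) ∧ (all (_≤ᵇ t) σ ∧ Q σ)))
    ≡ rangeGF b lo t a₁ 0 n₁ ℤ.* Y (a ∸ a₁) 0 (n ∸ n₁)
  term a₁ n₁ =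
    trans (cong₂ (λ L S → ℤ.+ (L * S))
                 (tally-replicate b t (n ∸ n₁) (a ∸ a₁) lo lo≤)
                 (tally-cong (partitionsOf b n₁) _ _
                     (λ {σ} _ → cong ((length σ ≡ᵇ a₁) ∧_) (all-≤ᵇ-inRange t lo σ))))
          (trans (+[m*n]≡+n*+m replicates smalls) (cong (rangeGF b lo t a₁ 0 n₁ ℤ.*_) (sym (Y₀ (a ∸ a₁) (n ∸ n₁)))))
    where
    replicates = fromBool ((n ∸ n₁ ≡ᵇ suc t * (a ∸ a₁)) ∧ decreasingBy (fromBool b) (replicate (a ∸ a₁) (suc t)))
    smalls = tally (partitionsOf b n₁) (λ σ → (length σ ≡ᵇ a₁) ∧ all (inRange lo t) σ)
  by-degree : ∀ c →
    sumTo a (λ a₁ → sumTo n (λ n₁ → rangeGF b lo t a₁ 0 n₁ ℤ.* Y (a ∸ a₁) c (n ∸ n₁)))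
        ≡ rangeGF b lo (suc t) a c n
  by-degree (suc c) = sumTo-zero a _ (λ a₁ _ → sumTo-zero n _ (λ n₁ _ →
    trans (cong (rangeGF b lo t a₁ 0 n₁ ℤ.*_) (Y₊ (a ∸ a₁) c (n ∸ n₁))) (ℤP.*-zeroʳ (rangeGF b lo t a₁ 0 n₁))))
  by-degree zero = sym
    (trans (cong ℤ.+_ (SplitAt.tally≡convolution b t n a Q Q Q (λ β σ _ _ _ → all-++ (inRange lo (suc t)) β σ)))
    (trans (sumTo-pos a _)
           (sumTo-cong a _ _ (λ a₁ _ → trans (sumTo-pos n _) (sumTo-cong n _ _ (λ n₁ _ → term a₁ n₁))))))

decreasingBy0-replicate : ∀ u c → decreasingBy 0 (replicate u c) ≡ true
decreasingBy0-replicate zero          c = refl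
decreasingBy0-replicate (suc zero)    c = refl
decreasingBy0-replicate (suc (suc u)) c = ∧-true⁺ (≤ᵇ⁺ {c} ≤-refl) (decreasingBy0-replicate (suc u) c)

invPoch≈rangeGF : ∀ m → invPoch (ℤ.+ 1) 1 m ≈ rangeGF false 1 m
invPoch≈rangeGF zero            = rangeGF-empty false 1 0 (s≤s z≤n)
invPoch≈rangeGF (suc m) a c n   =
  trans (*ₚ-congˡ (invOneMinus (ℤ.+ 1) (suc m)) (invPoch≈rangeGF m) a c n)
        (rangeGF-*ₚ false 1 m (invOneMinus (ℤ.+ 1) (suc m)) (s≤s z≤n) geometric (λ _ _ _ → refl) a c n)
  where
  geometric : ∀ u w → invOneMinus (ℤ.+ 1) (suc m) u 0 w
      ≡ ℤ.+ fromBool ((w ≡ᵇ suc m * u) ∧ decreasingBy 0 (replicate u (suc m)))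
  geometric u w rewrite decreasingBy0-replicate u (suc m) | ∧-identityʳ (w ≡ᵇ suc m * u) with w ≡ᵇ suc m * u
  ... | true  = ℤP.^-zeroˡ u
  ... | false = refl

poch≈rangeGF : ∀ m → poch -[1+ 0 ] 2 m ≈ rangeGF true 2 (suc m)
poch≈rangeGF zero          = rangeGF-empty true 2 1 ≤-refl
poch≈rangeGF (suc m) a c n =
  trans (*ₚ-congˡ (oneMinus -[1+ 0 ] (2 + m)) (poch≈rangeGF m) a c n)
        (rangeGF-*ₚ true 2 (suc m) (oneMinus -[1+ 0 ] (2 + m)) (s≤s (s≤s z≤n)) at-most-once off-degree a c n)
  where
  at-most-once : ∀ u w → oneMinus -[1+ 0 ] (2 + m) u 0 w ≡
    ℤ.+ fromBool ((w ≡ᵇ suc (suc m) * u) ∧ decreasingBy 1 (replicate u (suc (suc m))))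
  at-most-once zero w rewrite *-zeroʳ (suc (suc m)) | ∧-identityʳ (w ≡ᵇ 0) with w ≡ᵇ 0
  ... | true  = refl
  ... | false = refl
  at-most-once (suc zero) w rewrite *-identityʳ (suc (suc m)) | ∧-identityʳ (w ≡ᵇ suc (suc m)) with w ≡ᵇ suc (suc m)
  ... | true  = refl
  ... | false = refl
  at-most-once (suc (suc u)) w rewrite ≤ᵇ-false⁺ {suc (suc (suc m))} {suc (suc m)} 1+n≰n
      | ∧-zeroʳ (w ≡ᵇ suc (suc m) * suc (suc u)) = refl
  off-degree : ∀ u c w → oneMinus -[1+ 0 ] (2 + m) u (suc c) w ≡ ℤ.+ 0
  off-degree u c w rewrite ∧-zeroʳ (u ≡ᵇ 0) | ∧-zeroʳ (u ≡ᵇ 1) = refl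

-- The functional equations

generatingFunction : Bool → ℕ → PS
generatingFunction b k a c n = ℤ.+ tally (partitionsOf b n) (λ l → (length l ≡ᵇ a) ∧ (μ k l ≡ᵇ c))

smallPartsFactor : Bool → ℕ → PS
smallPartsFactor false k = invPoch (ℤ.+ 1) 1 k
smallPartsFactor true  k = poch -[1+ 0 ] 2 (k ∸ 1)

smallPartsFactor≈rangeGF : ∀ b k → smallPartsFactor b (suc k) ≈ rangeGF b (suc (fromBool b)) (suc k)
smallPartsFactor≈rangeGF false k = invPoch≈rangeGF (suc k)
smallPartsFactor≈rangeGF true  k = poch≈rangeGF k

not-hasPartOne : ∀ l → all (1 ≤ᵇ_) l ≡ true → not (hasPartOne l) ≡ all (1 <ᵇ_) l
not-hasPartOne []                 _   = refl
not-hasPartOne (suc zero ∷ l)     _   = refl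
not-hasPartOne (suc (suc p) ∷ l) pos = not-hasPartOne l pos

tally-withoutPartOne : ∀ b k a c n →
  tally (partitionsOf b n) (λ l → ((length l ≡ᵇ a) ∧ (μ k l ≡ᵇ c)) ∧ not (hasPartOne l)) ≡
  (if 1 * a ≤ᵇ n then tally (partitionsOf b (n ∸ 1 * a)) (λ l → (length l ≡ᵇ a) ∧ (μ k l ≡ᵇ c)) else 0)
tally-withoutPartOne b k a c n =
  trans (tally-cong (partitionsOf b n) _ (λ l → (length l ≡ᵇ a) ∧ (all (1 <ᵇ_) l ∧ (μ k l ≡ᵇ c)))
          (λ {l} l∈ → let (_ , _ , pos) = sound (partitionsOf-enumerates b n) l∈ in
            trans (cong (((length l ≡ᵇ a) ∧ (μ k l ≡ᵇ c)) ∧_) (not-hasPartOne l pos))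
                  (trans (∧-assoc (length l ≡ᵇ a) _ _) (cong ((length l ≡ᵇ a) ∧_) (∧-comm (μ k l ≡ᵇ c) _)))))
        (tally-shift b 1 n a (λ l → μ k l ≡ᵇ c) (λ l → μ k l ≡ᵇ c) (λ ν → cong (_≡ᵇ c) (μ-map-+ k 1 ν)))

+[m+n]-+n≡+m : ∀ m n → ℤ.+ (m + n) ℤ.- ℤ.+ n ≡ ℤ.+ m
+[m+n]-+n≡+m m n = trans (ℤP.m-n≡m⊖n (m + n) n) (trans (ℤP.⊖-≥ (m≤n+m n m)) (cong ℤ.+_ (m+n∸n≡m m n)))

+[m+if]-if≡+m : ∀ (p : Bool) m n → ℤ.+ (m + (if p then n else 0)) ℤ.- (if p then ℤ.+ n else ℤ.+ 0) ≡ ℤ.+ m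
+[m+if]-if≡+m true  m n = +[m+n]-+n≡+m m n
+[m+if]-if≡+m false m n = trans (cong (λ x → ℤ.+ x ℤ.- ℤ.+ 0) (+-identityʳ m)) (ℤP.+-identityʳ (ℤ.+ m))

countWithPartOne : Bool → ℕ → ℕ → ℕ → ℕ → ℕ
countWithPartOne b k a c n = tally (partitionsOf b n) (λ l → (length l ≡ᵇ a) ∧ ((μ k l ≡ᵇ c) ∧ hasPartOne l))

generatingFunction-substY1 : ∀ b k a c n →
  (generatingFunction b k -ₚ substY 1 (generatingFunction b k)) a c n ≡ ℤ.+ countWithPartOne b k a c n
generatingFunction-substY1 b k a c n =
  trans (cong (ℤ._- substY 1 (generatingFunction b k) a c n) (cong ℤ.+_ by-partOne))
        (+[m+if]-if≡+m (1 * a ≤ᵇ n) (countWithPartOne b k a c n) (tally (partitionsOf b (n ∸ 1 * a)) counted))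
  where
  counted : List ℕ → Bool
  counted l = (length l ≡ᵇ a) ∧ (μ k l ≡ᵇ c)
  by-partOne : tally (partitionsOf b n) counted ≡
    countWithPartOne b k a c n + (if 1 * a ≤ᵇ n then tally (partitionsOf b (n ∸ 1 * a)) counted else 0)
  by-partOne = trans (tally-split (partitionsOf b n) counted hasPartOne)
    (cong₂ _+_ (tally-cong (partitionsOf b n) _ _ (λ {l} _ → ∧-assoc (length l ≡ᵇ a) (μ k l ≡ᵇ c) (hasPartOne l)))
               (tally-withoutPartOne b k a c n))

-- A block of parts at most k containing a 1 is that 1 (the factor yzq) plus parts in [1 + fromBool b, k].
mono-smallPartsFactor : ∀ b k a₁ n₁ →
  ℤ.+ tally (partitionsOf b n₁) (λ σ → (length σ ≡ᵇ a₁) ∧ (all (_≤ᵇ suc k) σ ∧ hasPartOne σ)) ≡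
  (mono 1 1 1 *ₚ smallPartsFactor b (suc k)) a₁ 1 n₁
mono-smallPartsFactor b k zero n₁ rewrite mono-*ₚ (smallPartsFactor b (suc k)) 0 1 n₁ =
  cong ℤ.+_ (tally-none (partitionsOf b n₁) _ (λ {σ} _ → nonempty σ))
  where
  nonempty : ∀ σ → ((length σ ≡ᵇ 0) ∧ (all (_≤ᵇ suc k) σ ∧ hasPartOne σ)) ≡ false
  nonempty []      = refl
  nonempty (_ ∷ _) = refl
mono-smallPartsFactor false k (suc a₁) zero rewrite mono-*ₚ (smallPartsFactor false (suc k)) (suc a₁) 1 0 = refl
mono-smallPartsFactor true  k (suc a₁) zero rewrite mono-*ₚ (smallPartsFactor true (suc k)) (suc a₁) 1 0 = refl
mono-smallPartsFactor b     k (suc a₁) (suc n₁) rewrite mono-*ₚ (smallPartsFactor b (suc k)) (suc a₁) 1 (suc n₁) =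
  trans (cong ℤ.+_ (tally-removeOne b (suc k) a₁ n₁ (s≤s z≤n))) (sym (smallPartsFactor≈rangeGF b k a₁ 0 n₁))

-- Splitting off the parts at most k leaves a partition with parts above k and one less in μ_k, counted by F_k(yq^k).
substYk-coefficient : ∀ b k a c n →
  ((mono 1 1 1 *ₚ smallPartsFactor b (suc k)) *ₚ substY (suc k) (generatingFunction b (suc k))) a c n ≡
  ℤ.+ countWithPartOne b (suc k) a c n
substYk-coefficient b k a c n = trans (*ₚ-concentratedˡ yzqA S 1 off-degree a c n) (by-degree c)
  where
  yzqA = mono 1 1 1 *ₚ smallPartsFactor b (suc k)
  S = substY (suc k) (generatingFunction b (suc k))

  off-degree : ∀ a₁ c₁ n₁ → c₁ ≢ 1 → yzqA a₁ c₁ n₁ ≡ ℤ.+ 0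
  off-degree a₁ zero n₁ _ rewrite mono-*ₚ (smallPartsFactor b (suc k)) a₁ 0 n₁ | ∧-zeroʳ (1 ≤ᵇ a₁) = refl
  off-degree a₁ (suc zero) n₁ c₁≢1 = ⊥-elim (c₁≢1 refl)
  off-degree a₁ (suc (suc c₁)) n₁ _
    rewrite mono-*ₚ (smallPartsFactor b (suc k)) a₁ (suc (suc c₁)) n₁
        | smallPartsFactor≈rangeGF b k (a₁ ∸ 1) (suc c₁) (n₁ ∸ 1) =
    if-eta ((1 ≤ᵇ a₁) ∧ (1 ≤ᵇ n₁))

  by-degree : ∀ c →
    (if 1 ≤ᵇ c then sumTo a (λ a₁ → sumTo n (λ n₁ → yzqA a₁ 1 n₁ ℤ.* S (a ∸ a₁) (c ∸ 1) (n ∸ n₁)))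
        else ℤ.+ 0) ≡
    ℤ.+ countWithPartOne b (suc k) a c n
  by-degree zero = sym (cong ℤ.+_ (tally-none (partitionsOf b n) _ (λ {l} _ → μ≢0 l)))
    where
    μ≢0 : ∀ l → ((length l ≡ᵇ a) ∧ ((μ (suc k) l ≡ᵇ 0) ∧ hasPartOne l)) ≡ false
    μ≢0 []       = ∧-zeroʳ _
    μ≢0 (x ∷ xs) with μ (suc k) (x ∷ xs) | 1≤μ (suc k) x xs
    ... | suc _ | _ = ∧-zeroʳ _
  by-degree (suc c) = sym
    (trans (cong ℤ.+_ (SplitAt.tally≡convolution b (suc k) n a (λ l → (μ (suc k) l ≡ᵇ suc c) ∧ hasPartOne l)
                         (λ β → suc (μ (suc k) β) ≡ᵇ suc c) hasPartOne
                         (λ β σ → μ-hasPartOne-++ (suc k) (suc c) β σ (s≤s z≤n))))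
    (trans (sumTo-pos a _)
           (sumTo-cong a _ _ (λ a₁ _ → trans (sumTo-pos n _) (sumTo-cong n _ _ (λ n₁ _ → term a₁ n₁))))))
    where
    large : ℕ → ℕ → ℕ
    large a₁ n₁ =
      tally (partitionsOf b (n ∸ n₁)) (λ β → (length β ≡ᵇ a ∸ a₁)
          ∧ (all (suc k <ᵇ_) β ∧ (suc (μ (suc k) β) ≡ᵇ suc c)))
    small : ℕ → ℕ → ℕ
    small a₁ n₁ = tally (partitionsOf b n₁) (λ σ → (length σ ≡ᵇ a₁) ∧ (all (_≤ᵇ suc k) σ ∧ hasPartOne σ))
    term : ∀ a₁ n₁ → ℤ.+ (large a₁ n₁ * small a₁ n₁) ≡ yzqA a₁ 1 n₁ ℤ.* S (a ∸ a₁) c (n ∸ n₁)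
    term a₁ n₁ =
      trans (+[m*n]≡+n*+m (large a₁ n₁) (small a₁ n₁))
            (cong₂ ℤ._*_ (mono-smallPartsFactor b k a₁ n₁)
                         (trans (cong ℤ.+_ (tally-shift b (suc k) (n ∸ n₁) (a ∸ a₁) _ (λ ν → μ (suc k) ν ≡ᵇ c)
                                                         (λ ν → cong (_≡ᵇ c) (μ-map-+ (suc k) (suc k) ν))))
                                (if-float ℤ.+_ (suc k * (a ∸ a₁) ≤ᵇ n ∸ n₁))))

functionalEquation : ∀ b k →
  (generatingFunction b (suc k) -ₚ substY 1 (generatingFunction b (suc k))) ≈
  ((mono 1 1 1 *ₚ smallPartsFactor b (suc k)) *ₚ substY (suc k) (generatingFunction b (suc k)))
functionalEquation b k a c n = trans (generatingFunction-substY1 b (suc k) a c n) (sym (substYk-coefficient b k a c n))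

lemma2p1 : (k : ℕ) → 1 ≤ k →
    ((F k -ₚ substY 1 (F k)) ≈ ((mono 1 1 1 *ₚ invPoch (Data.Integer.+ 1) 1 k) *ₚ substY k (F k)))
    × ((G k -ₚ substY 1 (G k)) ≈ ((mono 1 1 1 *ₚ poch -[1+ 0 ] 2 (k ∸ 1)) *ₚ substY k (G k)))
lemma2p1 (suc k) _ = functionalEquation false k , functionalEquation true k
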